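{- Let $n\ge 1$, let $V=\mathbb{C}e_1\oplus\cdots\oplus\mathbb{C}e_n$ be the $n$-dimensional permutation representation of $S_n$ (with $\sigma(e_i)=e_{\sigma(i)}$), let $\chi_N$ be the character of $S^N V$, and let $D(n)$ be the dimension of the complex vector space of class functions on $S_n$ spanned by all $\chi_N$, $N\ge 0$. For each partition $\lambda=(\lambda_1,\dots,\lambda_k)$ of $n$ put $$f_\lambda(q)=\frac{1}{(1-q^{\lambda_1})\cdots(1-q^{\lambda_k})}\in\mathbb{C}[[q]],$$ and let $F_n\subset\mathbb{C}[[q]]$ be the complex span of the $f_\lambda(q)$ over all partitions $\lambda$ of $n$. Then $\dim F_n=D(n)$. -}

module Defs where

open import Level using (Level; _⊔_) renaming (suc to lsuc)
open import Data.Nat using (ℕ; zero; suc; _∸_; _≥_; _≤_)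
open import Data.Nat.Divisibility using (_∣?_)
open import Data.Fin using (Fin)
open import Data.Fin.Permutation using (Permutation′; _⟨$⟩ˡ_)
open import Data.Vec using (Vec; []; _∷_; lookup; tabulate)
open import Data.Vec.Properties using (≡-dec)
open import Data.List using (List; []; _∷_; [_]; map; concatMap; upTo; foldr)
open import Data.Nat.ListAction using (sum)
open import Data.List.Relation.Unary.All using (All)
open import Data.List.Relation.Unary.Linked using (Linked)
open import Data.Product using (Σ; _×_)
open import Data.Bool using (if_then_else_)
open import Relation.Nullary using (¬_; ⌊_⌋)
open import Relation.Binary.PropositionalEquality using (_≡_)
open import Algebra.Bundles using (CommutativeRing)
import Data.Nat as ℕ

record Field (c ℓ : Level) : Set (lsuc (c ⊔ ℓ)) where
  field
    commutativeRing : CommutativeRing c ℓ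
  open CommutativeRing commutativeRing public
  field
    1≉0     : ¬ (1# ≈ 0#)
    inverse : ∀ x → ¬ (x ≈ 0#) → Σ Carrier (λ y → (x * y) ≈ 1#)

module _ {c ℓ : Level} (K : Field c ℓ) where
  open Field K

  fromℕ : ℕ → Carrier
  fromℕ zero    = 0#
  fromℕ (suc m) = 1# + fromℕ m

  CharZero : Set ℓ
  CharZero = ∀ m → ¬ (fromℕ (suc m) ≈ 0#)

  sumK : List Carrier → Carrier
  sumK = foldr _+_ 0#

  lincomb : ∀ {d : ℕ} {a} {X : Set a} → (Fin d → Carrier) → (Fin d → X → Carrier) → X → Carrier
  lincomb {zero}  c w x = 0#
  lincomb {suc d} c w x = (c Fin.zero * w Fin.zero x) + lincomb (λ j → c (Fin.suc j)) (λ j → w (Fin.suc j)) x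
    where import Data.Fin as Fin

  LinIndep : ∀ {d : ℕ} {a} {X : Set a} → (Fin d → X → Carrier) → Set (a ⊔ c ⊔ ℓ)
  LinIndep {d} w = ∀ (cs : Fin d → Carrier) → (∀ x → lincomb cs w x ≈ 0#) → ∀ j → cs j ≈ 0#

  InSpan : ∀ {d : ℕ} {a} {X : Set a} → (Fin d → X → Carrier) → (X → Carrier) → Set (a ⊔ c ⊔ ℓ)
  InSpan {d} w u = Σ (Fin d → Carrier) (λ cs → ∀ x → lincomb cs w x ≈ u x)

  SpanDim : ∀ {i a} {I : Set i} {X : Set a} → (I → X → Carrier) → ℕ → Set (i ⊔ a ⊔ c ⊔ ℓ)
  SpanDim {I = I} v d = Σ (Fin d → I) (λ b → LinIndep (λ j → v (b j)) × (∀ i → InSpan (λ j → v (b j)) (v i)))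

  -- exponent vectors of the degree-N monomials e_1^{m_1}⋯e_n^{m_n}
  -- (the standard basis of S^N V)
  monomials : (n N : ℕ) → List (Vec ℕ n)
  monomials zero    zero    = [ [] ]
  monomials zero    (suc _) = []
  monomials (suc n) N = concatMap (λ a → map (a ∷_) (monomials n (N ∸ a))) (upTo (suc N))

  -- σ(e_i) = e_{σ(i)} sends e^m to e^{σ·m} with (σ·m)_j = m_{σ⁻¹(j)}
  act : ∀ {n} → Permutation′ n → Vec ℕ n → Vec ℕ n
  act σ m = tabulate (λ j → lookup m (σ ⟨$⟩ˡ j))

  -- χ_N(σ) = trace of σ on S^N V, computed in the monomial basis:
  -- Σ_m (coefficient of e^m in σ(e^m)).
  χ : (n : ℕ) → ℕ → Permutation′ n → Carrier
  χ n N σ = sumK (map (λ m → if ⌊ ≡-dec ℕ._≟_ (act σ m) m ⌋ then 1# else 0#) (monomials n N))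

  PowerSeries : Set c
  PowerSeries = ℕ → Carrier

  oneₚ : PowerSeries
  oneₚ zero    = 1#
  oneₚ (suc _) = 0#

  _*ₚ_ : PowerSeries → PowerSeries → PowerSeries
  (f *ₚ g) N = sumK (map (λ i → f i * g (N ∸ i)) (upTo (suc N)))

  -- 1/(1 - q^m) = Σ_{j ≥ 0} q^{m j}   (for m ≥ 1)
  geom : ℕ → PowerSeries
  geom m N = if ⌊ m ∣? N ⌋ then 1# else 0#

  fλ : List ℕ → PowerSeries
  fλ parts = foldr (λ p g → geom p *ₚ g) oneₚ parts

record Partition (n : ℕ) : Set where
  field
    parts       : List ℕ
    positive    : All (λ p → 1 ≤ p) parts
    nonincrease : Linked _≥_ parts
    total       : sum parts ≡ n

fFamily : ∀ {c ℓ} (K : Field c ℓ) (n : ℕ) → Partition n → PowerSeries K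
fFamily K n λ' = fλ K (Partition.parts λ')

module Submission where

-- A monomial of degree N is fixed by σ exactly when its exponents are constant on the cycles
-- of σ, so χ_N(σ) is the coefficient of q^N in f_λ(q) for λ the cycle type of σ, and every
-- partition of n is a cycle type. Thus, for the matrix F with rows f_λ (λ ⊢ n) and columns
-- N ≥ 0, the χ_N are the columns and the f_λ the rows, and the theorem says that row rank
-- equals column rank. F has infinitely many columns, but the invertible series
-- (1 - q^L)^n, L = n!, turns every f_λ into a polynomial of degree at most n (L + 1), so linear
-- relations between rows are decided on finitely many columns. Gaussian elimination on that
-- finite block, whose entries are natural numbers and hence can be tested for zero in
-- characteristic zero, yields a row basis and a column basis of the same size.

open import Defs
open import Data.Nat using (ℕ; _≤_)
open import Data.Product using (∃; _×_)
open import Algebra.Bundles using (CommutativeSemiring)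
open import Data.Fin using (toℕ)
open import Data.Product using (Σ; _,_)

module FormalPowerSeries {c ℓ} (S : CommutativeSemiring c ℓ) where
  open import Data.Nat as ℕ using (ℕ; zero; suc; _∸_; _≤_; _<_; _≡ᵇ_; z≤n; s≤s)
  import Data.Nat.Properties as ℕ
  open import Data.Nat.Divisibility using (_∣?_)
  open import Data.Fin using (Fin)
  open import Data.List using (List; foldr)
  open import Data.List.Relation.Binary.Permutation.Propositional as ↭ using (_↭_)
  open import Data.Bool using (true; false; if_then_else_; T)
  open import Data.Empty using (⊥-elim)
  open import Function using (_∘_)
  open import Relation.Nullary using (⌊_⌋; yes; no)
  import Relation.Binary.PropositionalEquality as ≡
  open ≡ using (_≢_)

  open CommutativeSemiring S
  open import Algebra.Properties.Semiring.Sum semiring public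
    using (sum; ∑-distrib-+; *-distribˡ-sum; sum-cong-≋; sum-replicate-zero)
  open import Algebra.Properties.Monoid.Sum +-monoid public using (sum-syntax)
  open import Algebra.Properties.CommutativeSemigroup *-commutativeSemigroup using (x∙yz≈y∙xz)
  open import Algebra.Properties.CommutativeSemigroup +-commutativeSemigroup using (interchange)
  open import Relation.Binary.Reasoning.Setoid setoid

  Series : Set c
  Series = ℕ → Carrier

  infix 4 _≈ₛ_
  _≈ₛ_ : Series → Series → Set ℓ
  f ≈ₛ g = ∀ N → f N ≈ g N

  ∑≤ : ℕ → Series → Carrier
  ∑≤ zero    f = f 0
  ∑≤ (suc N) f = f 0 + ∑≤ N (f ∘ suc)

  ∑≤-cong : ∀ N {f g} → (∀ i → i ≤ N → f i ≈ g i) → ∑≤ N f ≈ ∑≤ N g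
  ∑≤-cong zero    f≈g = f≈g 0 z≤n
  ∑≤-cong (suc N) f≈g = +-cong (f≈g 0 z≤n) (∑≤-cong N (λ i i≤N → f≈g (suc i) (s≤s i≤N)))

  ∑≤-zero : ∀ N {f} → (∀ i → i ≤ N → f i ≈ 0#) → ∑≤ N f ≈ 0#
  ∑≤-zero zero    f≈0 = f≈0 0 z≤n
  ∑≤-zero (suc N) f≈0 = trans (+-cong (f≈0 0 z≤n) (∑≤-zero N (λ i i≤N → f≈0 (suc i) (s≤s i≤N)))) (+-identityˡ 0#)

  ∑≤-+ : ∀ N f g → ∑≤ N (λ i → f i + g i) ≈ ∑≤ N f + ∑≤ N g
  ∑≤-+ zero    f g = refl
  ∑≤-+ (suc N) f g = trans (+-congˡ (∑≤-+ N (f ∘ suc) (g ∘ suc))) (interchange _ _ _ _)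

  ∑≤-*ˡ : ∀ N a f → ∑≤ N (λ i → a * f i) ≈ a * ∑≤ N f
  ∑≤-*ˡ zero    a f = refl
  ∑≤-*ˡ (suc N) a f = trans (+-congˡ (∑≤-*ˡ N a (f ∘ suc))) (sym (distribˡ a _ _))

  ∑≤-*ʳ : ∀ N a f → ∑≤ N (λ i → f i * a) ≈ ∑≤ N f * a
  ∑≤-*ʳ N a f = begin
    ∑≤ N (λ i → f i * a) ≈⟨ ∑≤-cong N (λ i _ → *-comm (f i) a) ⟩
    ∑≤ N (λ i → a * f i) ≈⟨ ∑≤-*ˡ N a f ⟩
    a * ∑≤ N f           ≈⟨ *-comm a _ ⟩
    ∑≤ N f * a           ∎

  sum-zero : ∀ {d} {f : Fin d → Carrier} → (∀ l → f l ≈ 0#) → sum f ≈ 0#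
  sum-zero {d} f≈0 = trans (sum-cong-≋ f≈0) (sum-replicate-zero d)

  ∑≤-∑-comm : ∀ N {d} (F : ℕ → Fin d → Carrier) → ∑≤ N (λ i → ∑[ l < d ] F i l) ≈ ∑[ l < d ] ∑≤ N (λ i → F i l)
  ∑≤-∑-comm zero    F = refl
  ∑≤-∑-comm (suc N) F = trans (+-congˡ (∑≤-∑-comm N (F ∘ suc))) (sym (∑-distrib-+ (F 0) _))

  ∑≤-last : ∀ N f → ∑≤ (suc N) f ≈ ∑≤ N f + f (suc N)
  ∑≤-last zero    f = refl
  ∑≤-last (suc N) f = trans (+-congˡ (∑≤-last N (f ∘ suc))) (sym (+-assoc _ _ _))

  ∑≤-reverse : ∀ N f → ∑≤ N f ≈ ∑≤ N (λ i → f (N ∸ i))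
  ∑≤-reverse zero f = refl
  ∑≤-reverse (suc N) f = begin
    f 0 + ∑≤ N (f ∘ suc)                  ≈⟨ +-congˡ (∑≤-reverse N (f ∘ suc)) ⟩
    f 0 + ∑≤ N (λ i → f (suc (N ∸ i)))    ≈⟨ +-congˡ (∑≤-cong N (λ i i≤N → reflexive (≡.cong f (≡.sym (ℕ.+-∸-assoc 1 i≤N))))) ⟩
    f 0 + ∑≤ N (λ i → f (suc N ∸ i))      ≈⟨ +-comm _ _ ⟩
    ∑≤ N (λ i → f (suc N ∸ i)) + f 0      ≈⟨ +-congˡ (reflexive (≡.cong f (≡.sym (ℕ.n∸n≡0 N)))) ⟩
    ∑≤ N (λ i → f (suc N ∸ i)) + f (N ∸ N) ≈⟨ sym (∑≤-last N (λ i → f (suc N ∸ i))) ⟩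
    ∑≤ (suc N) (λ i → f (suc N ∸ i))      ∎

  -- Both sides sum H a b c over the triples with a + b + c = N.
  ∑≤-triangle : ∀ N (H : ℕ → ℕ → ℕ → Carrier) →
    ∑≤ N (λ a → ∑≤ (N ∸ a) (λ b → H a b (N ∸ a ∸ b))) ≈ ∑≤ N (λ j → ∑≤ j (λ a → H a (j ∸ a) (N ∸ j)))
  ∑≤-triangle zero H = refl
  ∑≤-triangle (suc N) H = begin
    ∑≤ (suc N) (λ b → H 0 b (suc N ∸ b)) + ∑≤ N (λ a → ∑≤ (N ∸ a) (λ b → H (suc a) b (N ∸ a ∸ b)))
      ≈⟨ +-congˡ (∑≤-triangle N (H ∘ suc)) ⟩
    ∑≤ (suc N) (λ b → H 0 b (suc N ∸ b)) + ∑≤ N (λ j → ∑≤ j (λ a → H (suc a) (j ∸ a) (N ∸ j)))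
      ≈⟨ +-assoc _ _ _ ⟩
    H 0 0 (suc N) + (∑≤ N (λ b → H 0 (suc b) (N ∸ b)) + ∑≤ N (λ j → ∑≤ j (λ a → H (suc a) (j ∸ a) (N ∸ j))))
      ≈⟨ +-congˡ (sym (∑≤-+ N _ _)) ⟩
    ∑≤ (suc N) (λ j → ∑≤ j (λ a → H a (j ∸ a) (suc N ∸ j))) ∎

  infixl 7 _⋆_
  _⋆_ : Series → Series → Series
  (f ⋆ g) N = ∑≤ N (λ i → f i * g (N ∸ i))

  ⋆-cong : ∀ {f f′ g g′} → f ≈ₛ f′ → g ≈ₛ g′ → f ⋆ g ≈ₛ f′ ⋆ g′
  ⋆-cong f≈f′ g≈g′ N = ∑≤-cong N (λ i _ → *-cong (f≈f′ i) (g≈g′ (N ∸ i)))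

  ⋆-congʳ : ∀ f {g g′} → g ≈ₛ g′ → f ⋆ g ≈ₛ f ⋆ g′
  ⋆-congʳ f {g} {g′} = ⋆-cong {f} {f} {g} {g′} (λ _ → refl)

  ⋆-congˡ : ∀ {f f′} g → f ≈ₛ f′ → f ⋆ g ≈ₛ f′ ⋆ g
  ⋆-congˡ {f} {f′} g f≈f′ = ⋆-cong {f} {f′} {g} {g} f≈f′ (λ _ → refl)

  ⋆-comm : ∀ f g → f ⋆ g ≈ₛ g ⋆ f
  ⋆-comm f g N = begin
    (f ⋆ g) N                                       ≈⟨ ∑≤-reverse N _ ⟩
    ∑≤ N (λ i → f (N ∸ i) * g (N ∸ (N ∸ i)))  ≈⟨ ∑≤-cong N (λ i i≤N →
                                                        trans (*-comm _ _) (*-congʳ (reflexive (≡.cong g (ℕ.m∸[m∸n]≡n i≤N))))) ⟩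
    (g ⋆ f) N                                       ∎

  ⋆-assoc : ∀ f g h → (f ⋆ g) ⋆ h ≈ₛ f ⋆ (g ⋆ h)
  ⋆-assoc f g h N = begin
    ((f ⋆ g) ⋆ h) N
      ≈⟨ ∑≤-cong N (λ j _ → sym (∑≤-*ʳ j (h (N ∸ j)) _)) ⟩
    ∑≤ N (λ j → ∑≤ j (λ a → f a * g (j ∸ a) * h (N ∸ j)))
      ≈⟨ sym (∑≤-triangle N (λ a b c → f a * g b * h c)) ⟩
    ∑≤ N (λ a → ∑≤ (N ∸ a) (λ b → f a * g b * h (N ∸ a ∸ b)))
      ≈⟨ ∑≤-cong N (λ a _ → trans (∑≤-cong (N ∸ a) (λ b _ → *-assoc _ _ _)) (∑≤-*ˡ (N ∸ a) (f a) _)) ⟩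
    (f ⋆ (g ⋆ h)) N ∎

  ⋆-swap : ∀ f g h → f ⋆ (g ⋆ h) ≈ₛ g ⋆ (f ⋆ h)
  ⋆-swap f g h N = begin
    (f ⋆ (g ⋆ h)) N ≈⟨ sym (⋆-assoc f g h N) ⟩
    ((f ⋆ g) ⋆ h) N ≈⟨ ⋆-congˡ h (⋆-comm f g) N ⟩
    ((g ⋆ f) ⋆ h) N ≈⟨ ⋆-assoc g f h N ⟩
    (g ⋆ (f ⋆ h)) N ∎

  ⋆-∑ : ∀ {d} f (a : Fin d → Carrier) (g : Fin d → Series) →
        f ⋆ (λ M → ∑[ l < d ] (a l * g l M)) ≈ₛ (λ N → ∑[ l < d ] (a l * (f ⋆ g l) N))
  ⋆-∑ {d} f a g N = begin
    ∑≤ N (λ i → f i * ∑[ l < d ] (a l * g l (N ∸ i)))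
      ≈⟨ ∑≤-cong N (λ i _ → *-distribˡ-sum (f i) (λ l → a l * g l (N ∸ i))) ⟩
    ∑≤ N (λ i → ∑[ l < d ] (f i * (a l * g l (N ∸ i))))
      ≈⟨ ∑≤-∑-comm N (λ i l → f i * (a l * g l (N ∸ i))) ⟩
    ∑[ l < d ] ∑≤ N (λ i → f i * (a l * g l (N ∸ i)))
      ≈⟨ sum-cong-≋ (λ l → trans (∑≤-cong N (λ i _ → x∙yz≈y∙xz _ _ _)) (∑≤-*ˡ N (a l) _)) ⟩
    ∑[ l < d ] (a l * (f ⋆ g l) N) ∎

  VanishesFrom : ℕ → Series → Set ℓ
  VanishesFrom s f = ∀ N → s ≤ N → f N ≈ 0#

  VanishesBelow : ℕ → Series → Set ℓ
  VanishesBelow s f = ∀ N → N < s → f N ≈ 0#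

  vanishesFrom-mono : ∀ {s t f} → s ≤ t → VanishesFrom s f → VanishesFrom t f
  vanishesFrom-mono s≤t f≈0 N t≤N = f≈0 N (ℕ.≤-trans s≤t t≤N)

  vanishesFrom-resp : ∀ {s f g} → f ≈ₛ g → VanishesFrom s g → VanishesFrom s f
  vanishesFrom-resp f≈g g≈0 N s≤N = trans (f≈g N) (g≈0 N s≤N)

  ⋆-vanishesFrom : ∀ {s t f g} → VanishesFrom s f → VanishesFrom t g → VanishesFrom (s ℕ.+ t) (f ⋆ g)
  ⋆-vanishesFrom {s} {t} {f} {g} f≈0 g≈0 N s+t≤N = ∑≤-zero N term≈0
    where
    term≈0 : ∀ i → i ≤ N → f i * g (N ∸ i) ≈ 0#
    term≈0 i _ with s ℕ.≤? i
    ... | yes s≤i = trans (*-congʳ (f≈0 i s≤i)) (zeroˡ _)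
    ... | no s≰i  = trans (*-congˡ (g≈0 (N ∸ i) t≤N∸i)) (zeroʳ _)
      where
      t≤N∸i : t ≤ N ∸ i
      t≤N∸i = ℕ.≤-trans (ℕ.≤-reflexive (≡.sym (ℕ.m+n∸m≡n i t)))
                (ℕ.∸-monoˡ-≤ i (ℕ.≤-trans (ℕ.+-monoˡ-≤ t (ℕ.<⇒≤ (ℕ.≰⇒> s≰i))) s+t≤N))

  ⋆-vanishesBelow : ∀ {s} f {g} → VanishesBelow s g → VanishesBelow s (f ⋆ g)
  ⋆-vanishesBelow f g≈0 N N<s = ∑≤-zero N (λ i _ →
    trans (*-congˡ (g≈0 (N ∸ i) (ℕ.≤-<-trans (ℕ.m∸n≤m N i) N<s))) (zeroʳ (f i)))

  monomial : ℕ → Series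
  monomial k N = if k ≡ᵇ N then 1# else 0#

  monomial-≢ : ∀ {k N} → k ≢ N → monomial k N ≈ 0#
  monomial-≢ {k} {N} k≢N with k ≡ᵇ N in k≡ᵇN
  ... | true  = ⊥-elim (k≢N (ℕ.≡ᵇ⇒≡ k N (≡.subst T (≡.sym k≡ᵇN) _)))
  ... | false = refl

  monomial-⋆ : ∀ k h N → k ≤ N → (monomial k ⋆ h) N ≈ h (N ∸ k)
  monomial-⋆ zero h zero _ = *-identityˡ _
  monomial-⋆ zero h (suc N) _ = begin
    1# * h (suc N) + ∑≤ N (λ i → 0# * h (N ∸ i)) ≈⟨ +-cong (*-identityˡ _) (∑≤-zero N (λ i _ → zeroˡ _)) ⟩
    h (suc N) + 0#                               ≈⟨ +-identityʳ _ ⟩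
    h (suc N)                                    ∎
  monomial-⋆ (suc k) h (suc N) (s≤s k≤N) = trans (+-cong (zeroˡ _) (monomial-⋆ k h N k≤N)) (+-identityˡ _)

  monomial-⋆-below : ∀ k h N → N < k → (monomial k ⋆ h) N ≈ 0#
  monomial-⋆-below (suc k) h zero _ = zeroˡ _
  monomial-⋆-below (suc k) h (suc N) (s≤s N<k) = trans (+-cong (zeroˡ _) (monomial-⋆-below k h N N<k)) (+-identityˡ _)

  ⋆-identityˡ : ∀ h → monomial 0 ⋆ h ≈ₛ h
  ⋆-identityˡ h N = monomial-⋆ 0 h N z≤n

  geometric : ℕ → Series
  geometric m N = if ⌊ m ∣? N ⌋ then 1# else 0#

  geometricProduct : List ℕ → Series
  geometricProduct = foldr (λ m g → geometric m ⋆ g) (monomial 0)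

  geometricProduct-↭ : ∀ {xs ys} → xs ↭ ys → geometricProduct xs ≈ₛ geometricProduct ys
  geometricProduct-↭ ↭.refl N = refl
  geometricProduct-↭ (↭.prep x xs↭ys) = ⋆-congʳ (geometric x) (geometricProduct-↭ xs↭ys)
  geometricProduct-↭ (↭.swap {xs} x y xs↭ys) N =
    trans (⋆-swap (geometric x) (geometric y) (geometricProduct xs) N)
          (⋆-congʳ (geometric y) (⋆-congʳ (geometric x) (geometricProduct-↭ xs↭ys)) N)
  geometricProduct-↭ (↭.trans xs↭ys ys↭zs) N = trans (geometricProduct-↭ xs↭ys N) (geometricProduct-↭ ys↭zs N)

module FixedMonomials where
  open import Data.Bool using (Bool; true; false; if_then_else_; _∧_; T)
  open import Data.Bool.Properties using (T-∧; T-≡)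
  open import Data.Empty using (⊥-elim)
  open import Data.Fin as Fin using (Fin; toℕ; _↑ˡ_; _↑ʳ_)
  open import Data.Fin.Permutation using (permutation)
  import Data.Fin.Properties as Fin
  open import Data.List using (List; []; _∷_; [_]; map; concatMap; upTo; applyUpTo; _++_)
  open import Data.List.Membership.Propositional using (_∈_; find; lose)
  open import Data.List.Membership.Propositional.Properties
    using (∈-map⁺; ∈-map⁻; ∈-concatMap⁺; ∈-concatMap⁻; ∈-upTo⁺; ∈-upTo⁻)
  open import Data.List.Membership.Propositional.Properties.WithK using (unique∧set⇒bag)
  open import Data.List.Relation.Binary.BagAndSetEquality using (∼bag⇒↭)
  open import Data.List.Relation.Binary.Disjoint.Propositional using (Disjoint)
  open import Data.List.Relation.Binary.Permutation.Propositional as ↭ using (_↭_)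
  open import Data.List.Relation.Unary.All as All using ([])
  open import Data.List.Relation.Unary.AllPairs using ([]; _∷_)
  open import Data.List.Relation.Unary.Any using (here; there)
  open import Data.List.Relation.Unary.Unique.Propositional using (Unique)
  import Data.List.Relation.Unary.Unique.Propositional.Properties as Unique
  open import Data.Nat as ℕ using (ℕ; zero; suc; _+_; _*_; _∸_; _<_; s≤s)
  open import Data.Nat.Divisibility using (_∣?_; divides)
  open import Data.Nat.Properties
  open import Data.Product using (_×_; _,_; proj₁; proj₂)
  open import Data.Sum using (inj₁; inj₂)
  open import Data.Vec as Vec using (Vec; []; _∷_; lookup; tabulate; replicate; take; drop)
  open import Data.Vec.Relation.Binary.Pointwise.Extensional using (ext; Pointwise-≡⇒≡)
  open import Data.Vec.Properties
    using (≡-dec; lookup∘tabulate; ∷-injective; lookup-replicate; take++drop≡id; lookup-++ˡ; lookup-++ʳ)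
  open import Function using (_∘_; id; _⇔_; mk⇔; module Equivalence)
  open import Function.Construct.Composition using (_⇔-∘_)
  open import Function.Construct.Symmetry using (⇔-sym)
  open import Data.Product.Function.NonDependent.Propositional using (_×-⇔_)
  open import Relation.Binary.PropositionalEquality hiding ([_])
  open import Relation.Nullary using (⌊_⌋; yes; no)
  open import Relation.Nullary.Decidable using (toWitness; fromWitness)
  open FormalPowerSeries +-*-commutativeSemiring
    using (∑≤; ∑≤-cong; ∑≤-zero; ∑≤-*ʳ; ∑≤-triangle; _⋆_; ⋆-congˡ; ⋆-identityˡ; geometric; monomial)
  import Algebra.Properties.CommutativeMonoid.Sum +-0-commutativeMonoid as ∑

  count : ∀ {a} {A : Set a} → (A → Bool) → List A → ℕ
  count b []       = 0
  count b (x ∷ xs) = if b x then suc (count b xs) else count b xs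

  count-++ : ∀ {a} {A : Set a} (b : A → Bool) xs ys → count b (xs ++ ys) ≡ count b xs + count b ys
  count-++ b []       ys = refl
  count-++ b (x ∷ xs) ys with b x
  ... | true  = cong suc (count-++ b xs ys)
  ... | false = count-++ b xs ys

  count-map : ∀ {a c} {A : Set a} {C : Set c} (b : C → Bool) (g : A → C) xs → count b (map g xs) ≡ count (b ∘ g) xs
  count-map b g []       = refl
  count-map b g (x ∷ xs) with b (g x)
  ... | true  = cong suc (count-map b g xs)
  ... | false = count-map b g xs

  count-cong : ∀ {a} {A : Set a} {b b′ : A → Bool} → (∀ x → b x ≡ b′ x) → ∀ xs → count b xs ≡ count b′ xs
  count-cong b≗b′ []       = refl
  count-cong {b′ = b′} b≗b′ (x ∷ xs) rewrite b≗b′ x with b′ x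
  ... | true  = cong suc (count-cong b≗b′ xs)
  ... | false = count-cong b≗b′ xs

  count-↭ : ∀ {a} {A : Set a} (b : A → Bool) {xs ys} → xs ↭ ys → count b xs ≡ count b ys
  count-↭ b ↭.refl = refl
  count-↭ b (↭.prep x p) with b x
  ... | true  = cong suc (count-↭ b p)
  ... | false = count-↭ b p
  count-↭ b (↭.swap x y p) with b x | b y
  ... | true  | true  = cong (suc ∘ suc) (count-↭ b p)
  ... | true  | false = cong suc (count-↭ b p)
  ... | false | true  = cong suc (count-↭ b p)
  ... | false | false = count-↭ b p
  count-↭ b (↭.trans p q) = trans (count-↭ b p) (count-↭ b q)

  count-none : ∀ {a} {A : Set a} (b : A → Bool) xs → (∀ x → x ∈ xs → b x ≡ false) → count b xs ≡ 0
  count-none b []       _    = refl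
  count-none b (x ∷ xs) none rewrite none x (here refl) = count-none b xs (λ y y∈xs → none y (there y∈xs))

  count-single : ∀ {a} {A : Set a} (b : A → Bool) {xs} x → Unique xs → x ∈ xs → b x ≡ true →
                 (∀ y → y ∈ xs → b y ≡ true → y ≡ x) → count b xs ≡ 1
  count-single b {y ∷ ys} x (y∉ys ∷ _) (here refl) bx≡true only rewrite bx≡true =
    cong suc (count-none b ys none)
    where
    none : ∀ z → z ∈ ys → b z ≡ false
    none z z∈ys with b z in bz
    ... | false = refl
    ... | true  = ⊥-elim (All.lookup y∉ys z∈ys (sym (only z (there z∈ys) bz)))
  count-single b {y ∷ ys} x (y∉ys ∷ ys!) (there x∈ys) bx≡true only with b y in by
  ... | true  = ⊥-elim (All.lookup y∉ys x∈ys (only y (here refl) by))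
  ... | false = count-single b x ys! x∈ys bx≡true (λ z z∈ys → only z (there z∈ys))

  count-concatMap : ∀ {a} {A : Set a} (b : A → Bool) (f : ℕ → List A) (h : ℕ → ℕ) N →
    count b (concatMap f (applyUpTo h (suc N))) ≡ ∑≤ N (λ i → count b (f (h i)))
  count-concatMap b f h zero    = trans (count-++ b (f (h 0)) []) (+-identityʳ _)
  count-concatMap b f h (suc N) =
    trans (count-++ b (f (h 0)) _) (cong (count b (f (h 0)) +_) (count-concatMap b f (h ∘ suc) N))

  -- A field-free copy of `monomials`: exponent vectors of the degree-N monomials, the standard basis of S^N V.
  exponents : (n N : ℕ) → List (Vec ℕ n)
  exponents zero    zero    = [ [] ]
  exponents zero    (suc _) = []
  exponents (suc n) N = concatMap (λ a → map (a ∷_) (exponents n (N ∸ a))) (upTo (suc N))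

  ∈-exponents : ∀ {n} (v : Vec ℕ n) → v ∈ exponents n (Vec.sum v)
  ∈-exponents []      = here refl
  ∈-exponents {suc n} (x ∷ v) =
    ∈-concatMap⁺ (λ a → map (a ∷_) (exponents n (x + Vec.sum v ∸ a)))
      (lose (∈-upTo⁺ (s≤s (m≤m+n x (Vec.sum v))))
            (∈-map⁺ (x ∷_) (subst (λ N → v ∈ exponents n N) (sym (m+n∸m≡n x (Vec.sum v))) (∈-exponents v))))

  ∈-exponents⁻ : ∀ n N (v : Vec ℕ n) → v ∈ exponents n N → Vec.sum v ≡ N
  ∈-exponents⁻ zero zero [] _ = refl
  ∈-exponents⁻ (suc n) N v v∈ with find (∈-concatMap⁻ (λ a → map (a ∷_) (exponents n (N ∸ a))) {xs = upTo (suc N)} v∈)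
  ... | a , a∈ , v∈a with ∈-map⁻ (a ∷_) v∈a
  ... | w , w∈ , refl = trans (cong (a +_) (∈-exponents⁻ n (N ∸ a) w w∈)) (m+[n∸m]≡n (≤-pred (∈-upTo⁻ a∈)))

  exponents-unique : ∀ n N → Unique (exponents n N)
  exponents-unique zero    zero    = [] ∷ []
  exponents-unique zero    (suc N) = []
  exponents-unique (suc n) N = unique-heads (upTo (suc N)) (Unique.upTo⁺ (suc N))
    where
    L : ℕ → List (Vec ℕ (suc n))
    L a = map (a ∷_) (exponents n (N ∸ a))

    unique-heads : ∀ as → Unique as → Unique (concatMap L as)
    unique-heads []       _          = []
    unique-heads (a ∷ as) (a∉ ∷ as!) =
      Unique.++⁺ (Unique.map⁺ (proj₂ ∘ ∷-injective) (exponents-unique n (N ∸ a))) (unique-heads as as!) disjoint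
      where
      disjoint : Disjoint (L a) (concatMap L as)
      disjoint (v∈La , v∈Las) with ∈-map⁻ (a ∷_) v∈La
      ... | _ , _ , refl with find (∈-concatMap⁻ L {xs = as} v∈Las)
      ... | a′ , a′∈ , v∈La′ with ∈-map⁻ (a′ ∷_) v∈La′
      ... | _ , _ , a∷≡a′∷ = All.lookup a∉ a′∈ (proj₁ (∷-injective a∷≡a′∷))

  Fixed : ∀ {n} → (Fin n → Fin n) → Vec ℕ n → Set
  Fixed p v = ∀ j → lookup v (p j) ≡ lookup v j

  isFixed : ∀ {n} → (Fin n → Fin n) → Vec ℕ n → Bool
  isFixed p v = ⌊ ≡-dec ℕ._≟_ (tabulate (λ j → lookup v (p j))) v ⌋

  Fixed⇔isFixed : ∀ {n} (p : Fin n → Fin n) v → Fixed p v ⇔ T (isFixed p v)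
  Fixed⇔isFixed p v = mk⇔
    (λ fixed → fromWitness (Pointwise-≡⇒≡ (ext λ j → trans (lookup∘tabulate (λ j → lookup v (p j)) j) (fixed j))))
    (λ fixed j → trans (sym (lookup∘tabulate (λ j → lookup v (p j)) j)) (cong (λ u → lookup u j) (toWitness fixed)))

  Fixed⇒isFixed : ∀ {n} (p : Fin n → Fin n) v → Fixed p v → isFixed p v ≡ true
  Fixed⇒isFixed p v = Equivalence.to T-≡ ∘ Equivalence.to (Fixed⇔isFixed p v)

  isFixed⇒Fixed : ∀ {n} (p : Fin n → Fin n) v → isFixed p v ≡ true → Fixed p v
  isFixed⇒Fixed p v = Equivalence.from (Fixed⇔isFixed p v) ∘ Equivalence.from T-≡

  T-injective : ∀ {x y} → (T x ⇔ T y) → x ≡ y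
  T-injective {false} {false} _   = refl
  T-injective {false} {true}  x⇔y = ⊥-elim (Equivalence.from x⇔y _)
  T-injective {true}  {false} x⇔y = ⊥-elim (Equivalence.to x⇔y _)
  T-injective {true}  {true}  _   = refl

  isFixed-cong : ∀ {m n} (p : Fin m → Fin m) (q : Fin n → Fin n) v w → (Fixed p v ⇔ Fixed q w) → isFixed p v ≡ isFixed q w
  isFixed-cong p q v w p⇔q = T-injective (Fixed⇔isFixed q w ⇔-∘ (p⇔q ⇔-∘ ⇔-sym (Fixed⇔isFixed p v)))

  isFixed-∧ : ∀ {n n₁ n₂} (p : Fin n → Fin n) (p₁ : Fin n₁ → Fin n₁) (p₂ : Fin n₂ → Fin n₂) v v₁ v₂ →
              (Fixed p v ⇔ (Fixed p₁ v₁ × Fixed p₂ v₂)) → isFixed p v ≡ isFixed p₁ v₁ ∧ isFixed p₂ v₂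
  isFixed-∧ p p₁ p₂ v v₁ v₂ p⇔p₁×p₂ = T-injective
    (⇔-sym T-∧ ⇔-∘ ((Fixed⇔isFixed p₁ v₁ ×-⇔ Fixed⇔isFixed p₂ v₂) ⇔-∘ (p⇔p₁×p₂ ⇔-∘ ⇔-sym (Fixed⇔isFixed p v))))

  sum-const : ∀ {n} (v : Vec ℕ n) c → (∀ j → lookup v j ≡ c) → Vec.sum v ≡ n * c
  sum-const []      c _     = refl
  sum-const (x ∷ v) c v≗c = cong₂ _+_ (v≗c Fin.zero) (sum-const v c (v≗c ∘ Fin.suc))

  fixedCount : ∀ {n} → (Fin n → Fin n) → ℕ → ℕ
  fixedCount {n} p N = count (isFixed p) (exponents n N)

  fixedCount-empty : ∀ (p : Fin 0 → Fin 0) → ∀ N → fixedCount p N ≡ monomial 0 N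
  fixedCount-empty p zero    = refl
  fixedCount-empty p (suc N) = refl

  relabel : ∀ {n} → (Fin n → Fin n) → Vec ℕ n → Vec ℕ n
  relabel u v = tabulate (lookup v ∘ u)

  lookup-relabel : ∀ {n} (u : Fin n → Fin n) v j → lookup (relabel u v) j ≡ lookup v (u j)
  lookup-relabel u v = lookup∘tabulate (lookup v ∘ u)

  relabel-inverse : ∀ {n} {u w : Fin n → Fin n} → (∀ y → u (w y) ≡ y) → ∀ v → relabel w (relabel u v) ≡ v
  relabel-inverse {u = u} {w} u∘w≗id v = Pointwise-≡⇒≡ (ext λ j →
    trans (lookup-relabel w (relabel u v) j) (trans (lookup-relabel u v (w j)) (cong (lookup v) (u∘w≗id j))))

  sum-relabel : ∀ {n} {u w : Fin n → Fin n} → (∀ y → u (w y) ≡ y) → (∀ x → w (u x) ≡ x) →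
                ∀ v → Vec.sum (relabel u v) ≡ Vec.sum v
  sum-relabel {u = u} {w} u∘w≗id w∘u≗id v = begin
    Vec.sum (relabel u v)        ≡⟨ sum≡∑ (relabel u v) ⟩
    ∑.sum (lookup (relabel u v)) ≡⟨ ∑.sum-cong-≗ (lookup-relabel u v) ⟩
    ∑.sum (lookup v ∘ u)         ≡⟨ sym (∑.sum-permute (lookup v) (permutation u w u∘w≗id w∘u≗id)) ⟩
    ∑.sum (lookup v)             ≡⟨ sym (sum≡∑ v) ⟩
    Vec.sum v                    ∎
    where
    open ≡-Reasoning
    sum≡∑ : ∀ {n} (v : Vec ℕ n) → Vec.sum v ≡ ∑.sum (lookup v)
    sum≡∑ []      = refl
    sum≡∑ (x ∷ v) = cong (x +_) (sum≡∑ v)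

  module _ {n} {u w : Fin n → Fin n} (u∘w≗id : ∀ y → u (w y) ≡ y) (w∘u≗id : ∀ x → w (u x) ≡ x) where

    relabel-exponents : ∀ N → map (relabel u) (exponents n N) ↭ exponents n N
    relabel-exponents N = ∼bag⇒↭ (unique∧set⇒bag
      (Unique.map⁺ relabel-injective (exponents-unique n N)) (exponents-unique n N) (mk⇔ into onto))
      where
      relabel-injective : ∀ {v v′} → relabel u v ≡ relabel u v′ → v ≡ v′
      relabel-injective {v} {v′} eq =
        trans (sym (relabel-inverse {u = u} u∘w≗id v)) (trans (cong (relabel w) eq) (relabel-inverse {u = u} u∘w≗id v′))

      relabel∈ : ∀ {u′ w′ : Fin n → Fin n} → (∀ y → u′ (w′ y) ≡ y) → (∀ x → w′ (u′ x) ≡ x) →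
                 ∀ {v} → v ∈ exponents n N → relabel u′ v ∈ exponents n N
      relabel∈ u′∘w′ w′∘u′ {v} v∈ = subst (λ M → relabel _ v ∈ exponents n M)
        (trans (sum-relabel u′∘w′ w′∘u′ v) (∈-exponents⁻ n N v v∈)) (∈-exponents (relabel _ v))

      into : ∀ {v} → v ∈ map (relabel u) (exponents n N) → v ∈ exponents n N
      into v∈ with ∈-map⁻ (relabel u) v∈
      ... | v′ , v′∈ , refl = relabel∈ u∘w≗id w∘u≗id v′∈

      onto : ∀ {v} → v ∈ exponents n N → v ∈ map (relabel u) (exponents n N)
      onto {v} v∈ = subst (_∈ map (relabel u) (exponents n N)) (relabel-inverse {u = w} {w = u} w∘u≗id v)
                          (∈-map⁺ (relabel u) (relabel∈ w∘u≗id u∘w≗id v∈))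

    isFixed-conjugate : ∀ (p : Fin n → Fin n) v → isFixed (u ∘ p ∘ w) v ≡ isFixed p (relabel u v)
    isFixed-conjugate p v = isFixed-cong (u ∘ p ∘ w) p v (relabel u v) (mk⇔ to from)
      where
      to : Fixed (u ∘ p ∘ w) v → Fixed p (relabel u v)
      to fixed j = begin
        lookup (relabel u v) (p j) ≡⟨ lookup-relabel u v (p j) ⟩
        lookup v (u (p j))         ≡⟨ cong (λ i → lookup v (u (p i))) (sym (w∘u≗id j)) ⟩
        lookup v (u (p (w (u j)))) ≡⟨ fixed (u j) ⟩
        lookup v (u j)             ≡⟨ sym (lookup-relabel u v j) ⟩
        lookup (relabel u v) j     ∎
        where open ≡-Reasoning
      from : Fixed p (relabel u v) → Fixed (u ∘ p ∘ w) v
      from fixed j = begin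
        lookup v (u (p (w j)))         ≡⟨ sym (lookup-relabel u v (p (w j))) ⟩
        lookup (relabel u v) (p (w j)) ≡⟨ fixed (w j) ⟩
        lookup (relabel u v) (w j)     ≡⟨ lookup-relabel u v (w j) ⟩
        lookup v (u (w j))             ≡⟨ cong (lookup v) (u∘w≗id j) ⟩
        lookup v j                     ∎
        where open ≡-Reasoning

    fixedCount-conjugate : ∀ (p : Fin n → Fin n) N → fixedCount (u ∘ p ∘ w) N ≡ fixedCount p N
    fixedCount-conjugate p N = begin
      count (isFixed (u ∘ p ∘ w)) (exponents n N)          ≡⟨ count-cong (isFixed-conjugate p) (exponents n N) ⟩
      count (isFixed p ∘ relabel u) (exponents n N)        ≡⟨ sym (count-map (isFixed p) (relabel u) (exponents n N)) ⟩
      count (isFixed p) (map (relabel u) (exponents n N))  ≡⟨ count-↭ (isFixed p) (relabel-exponents N) ⟩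
      count (isFixed p) (exponents n N)                    ∎
      where open ≡-Reasoning

  lookup-↑ˡ : ∀ k {m} (v : Vec ℕ (k + m)) t → lookup v (t ↑ˡ m) ≡ lookup (take k v) t
  lookup-↑ˡ k v t = trans (cong (λ u → lookup u (t ↑ˡ _)) (sym (take++drop≡id k v))) (lookup-++ˡ (take k v) (drop k v) t)

  lookup-↑ʳ : ∀ k {m} (v : Vec ℕ (k + m)) x → lookup v (k ↑ʳ x) ≡ lookup (drop k v) x
  lookup-↑ʳ k v x = trans (cong (λ u → lookup u (k ↑ʳ x)) (sym (take++drop≡id k v))) (lookup-++ʳ (take k v) (drop k v) x)

  count-split : ∀ k m (b₁ : Vec ℕ k → Bool) (b₂ : Vec ℕ m → Bool) N →
    count (λ v → b₁ (take k v) ∧ b₂ (drop k v)) (exponents (k + m) N) ≡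
    ((λ i → count b₁ (exponents k i)) ⋆ (λ j → count b₂ (exponents m j))) N
  count-split zero m b₁ b₂ N with b₁ [] in b₁[]
  ... | true  = sym (trans (⋆-congˡ (λ j → count b₂ (exponents m j)) exponents-0 N) (⋆-identityˡ (λ j → count b₂ (exponents m j)) N))
    where
    exponents-0 : ∀ i → count b₁ (exponents 0 i) ≡ monomial 0 i
    exponents-0 zero    rewrite b₁[] = refl
    exponents-0 (suc i) = refl
  ... | false = trans (count-false (exponents m N)) (sym (∑≤-zero N (λ i _ → cong (_* _) (exponents-0 i))))
    where
    count-false : ∀ {a} {A : Set a} (xs : List A) → count (λ _ → false) xs ≡ 0
    count-false []       = refl
    count-false (x ∷ xs) = count-false xs
    exponents-0 : ∀ i → count b₁ (exponents 0 i) ≡ 0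
    exponents-0 zero    rewrite b₁[] = refl
    exponents-0 (suc i) = refl
  count-split (suc k) m b₁ b₂ N = begin
    count b (concatMap (λ a → map (a ∷_) (exponents (k + m) (N ∸ a))) (upTo (suc N)))
      ≡⟨ count-concatMap b (λ a → map (a ∷_) (exponents (k + m) (N ∸ a))) id N ⟩
    ∑≤ N (λ a → count b (map (a ∷_) (exponents (k + m) (N ∸ a))))
      ≡⟨ ∑≤-cong N (λ a _ → trans (count-map b (a ∷_) (exponents (k + m) (N ∸ a))) (count-split k m (b₁ ∘ (a ∷_)) b₂ (N ∸ a))) ⟩
    ∑≤ N (λ a → ∑≤ (N ∸ a) (λ i → H a i (N ∸ a ∸ i)))
      ≡⟨ ∑≤-triangle N H ⟩
    ∑≤ N (λ j → ∑≤ j (λ a → H a (j ∸ a) (N ∸ j)))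
      ≡⟨ ∑≤-cong N (λ j _ → trans (∑≤-*ʳ j (c₂ (N ∸ j)) _) (cong (_* c₂ (N ∸ j)) (sym (c₁ j)))) ⟩
    ((λ i → count b₁ (exponents (suc k) i)) ⋆ c₂) N ∎
    where
    open ≡-Reasoning
    b : Vec ℕ (suc k + m) → Bool
    b v = b₁ (take (suc k) v) ∧ b₂ (drop (suc k) v)
    c₂ : ℕ → ℕ
    c₂ j = count b₂ (exponents m j)
    H : ℕ → ℕ → ℕ → ℕ
    H a i r = count (b₁ ∘ (a ∷_)) (exponents k i) * c₂ r
    c₁ : ∀ j → count b₁ (exponents (suc k) j) ≡ ∑≤ j (λ a → count (b₁ ∘ (a ∷_)) (exponents k (j ∸ a)))
    c₁ j = trans (count-concatMap b₁ (λ a → map (a ∷_) (exponents k (j ∸ a))) id j)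
                 (∑≤-cong j (λ a _ → count-map b₁ (a ∷_) (exponents k (j ∸ a))))

  module _ {k m} {p : Fin (k + m) → Fin (k + m)} {p₁ : Fin k → Fin k} {p₂ : Fin m → Fin m}
           (p-left : ∀ t → p (t ↑ˡ m) ≡ p₁ t ↑ˡ m) (p-right : ∀ x → p (k ↑ʳ x) ≡ k ↑ʳ p₂ x) where

    Fixed-blocks : ∀ v → Fixed p v ⇔ (Fixed p₁ (take k v) × Fixed p₂ (drop k v))
    Fixed-blocks v = mk⇔ (λ fixed → left fixed , right fixed) both
      where
      left : Fixed p v → Fixed p₁ (take k v)
      left fixed t = begin
        lookup (take k v) (p₁ t) ≡⟨ sym (lookup-↑ˡ k v (p₁ t)) ⟩
        lookup v (p₁ t ↑ˡ m)     ≡⟨ cong (lookup v) (sym (p-left t)) ⟩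
        lookup v (p (t ↑ˡ m))    ≡⟨ fixed (t ↑ˡ m) ⟩
        lookup v (t ↑ˡ m)        ≡⟨ lookup-↑ˡ k v t ⟩
        lookup (take k v) t      ∎
        where open ≡-Reasoning
      right : Fixed p v → Fixed p₂ (drop k v)
      right fixed x = begin
        lookup (drop k v) (p₂ x) ≡⟨ sym (lookup-↑ʳ k v (p₂ x)) ⟩
        lookup v (k ↑ʳ p₂ x)     ≡⟨ cong (lookup v) (sym (p-right x)) ⟩
        lookup v (p (k ↑ʳ x))    ≡⟨ fixed (k ↑ʳ x) ⟩
        lookup v (k ↑ʳ x)        ≡⟨ lookup-↑ʳ k v x ⟩
        lookup (drop k v) x      ∎
        where open ≡-Reasoning
      both : Fixed p₁ (take k v) × Fixed p₂ (drop k v) → Fixed p v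
      both (fixed₁ , fixed₂) j with Fin.splitAt k j in split
      ... | inj₁ t rewrite sym (Fin.splitAt⁻¹-↑ˡ split) =
        trans (cong (lookup v) (p-left t)) (trans (lookup-↑ˡ k v (p₁ t)) (trans (fixed₁ t) (sym (lookup-↑ˡ k v t))))
      ... | inj₂ x rewrite sym (Fin.splitAt⁻¹-↑ʳ split) =
        trans (cong (lookup v) (p-right x)) (trans (lookup-↑ʳ k v (p₂ x)) (trans (fixed₂ x) (sym (lookup-↑ʳ k v x))))

    fixedCount-blocks : ∀ N → fixedCount p N ≡ (fixedCount p₁ ⋆ fixedCount p₂) N
    fixedCount-blocks N = trans
      (count-cong (λ v → isFixed-∧ p p₁ p₂ v (take k v) (drop k v) (Fixed-blocks v)) (exponents (k + m) N))
      (count-split k m (isFixed p₁) (isFixed p₂) N)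

  Path : ∀ {n} → (Fin n → Fin n) → ℕ → Set
  Path p i = ∀ t → toℕ t < i → toℕ (p t) ≡ suc (toℕ t)

  module _ {k} {p : Fin (suc k) → Fin (suc k)} (path : Path p k) where

    Fixed-path : ∀ v → Fixed p v → ∀ j → lookup v j ≡ lookup v Fin.zero
    Fixed-path v fixed j = go (toℕ j) j refl
      where
      go : ∀ i (j : Fin (suc k)) → toℕ j ≡ i → lookup v j ≡ lookup v Fin.zero
      go zero    Fin.zero _ = refl
      go (suc i) j j≡1+i = begin
        lookup v j     ≡⟨ cong (lookup v) (sym pt≡j) ⟩
        lookup v (p t) ≡⟨ fixed t ⟩
        lookup v t     ≡⟨ go i t (Fin.toℕ-fromℕ< i<1+k) ⟩
        lookup v Fin.zero ∎
        where
        open ≡-Reasoning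
        1+i<1+k : suc i < suc k
        1+i<1+k = subst (_< suc k) j≡1+i (Fin.toℕ<n j)
        i<1+k : i < suc k
        i<1+k = <-trans (n<1+n i) 1+i<1+k
        t : Fin (suc k)
        t = Fin.fromℕ< i<1+k
        pt≡j : p t ≡ j
        pt≡j = Fin.toℕ-injective (begin
          toℕ (p t)     ≡⟨ path t (subst (_< k) (sym (Fin.toℕ-fromℕ< i<1+k)) (≤-pred 1+i<1+k)) ⟩
          suc (toℕ t)   ≡⟨ cong suc (Fin.toℕ-fromℕ< i<1+k) ⟩
          suc i         ≡⟨ sym j≡1+i ⟩
          toℕ j         ∎)

    -- The fixed exponent vectors of the cycle p are the constant ones.
    fixedCount-cycle : ∀ N → fixedCount p N ≡ geometric (suc k) N
    fixedCount-cycle N with suc k ∣? N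
    ... | yes (divides q N≡q*[1+k]) = count-single (isFixed p) (replicate (suc k) q) (exponents-unique (suc k) N)
            constant∈ (Fixed⇒isFixed p _ (λ j → trans (lookup-replicate (p j) q) (sym (lookup-replicate j q))))
            only-constant
      where
      constant∈ : replicate (suc k) q ∈ exponents (suc k) N
      constant∈ = subst (λ M → replicate (suc k) q ∈ exponents (suc k) M)
        (trans (sum-const (replicate (suc k) q) q (λ j → lookup-replicate j q)) (trans (*-comm (suc k) q) (sym N≡q*[1+k])))
        (∈-exponents (replicate (suc k) q))
      only-constant : ∀ v → v ∈ exponents (suc k) N → isFixed p v ≡ true → v ≡ replicate (suc k) q
      only-constant v v∈ fixed = Pointwise-≡⇒≡ (ext λ j → trans (const j) (trans v₀≡q (sym (lookup-replicate j q))))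
        where
        const : ∀ j → lookup v j ≡ lookup v Fin.zero
        const = Fixed-path v (isFixed⇒Fixed p v fixed)
        v₀≡q : lookup v Fin.zero ≡ q
        v₀≡q = *-cancelˡ-≡ (lookup v Fin.zero) q (suc k)
          (trans (sym (sum-const v _ const)) (trans (∈-exponents⁻ (suc k) N v v∈) (trans N≡q*[1+k] (*-comm q (suc k)))))
    ... | no 1+k∤N = count-none (isFixed p) (exponents (suc k) N) none
      where
      none : ∀ v → v ∈ exponents (suc k) N → isFixed p v ≡ false
      none v v∈ with isFixed p v in fixed
      ... | false = refl
      ... | true  = ⊥-elim (1+k∤N (divides (lookup v Fin.zero) (begin
        N                       ≡⟨ sym (∈-exponents⁻ (suc k) N v v∈) ⟩
        Vec.sum v               ≡⟨ sum-const v _ (Fixed-path v (isFixed⇒Fixed p v fixed)) ⟩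
        suc k * lookup v Fin.zero ≡⟨ *-comm (suc k) _ ⟩
        lookup v Fin.zero * suc k ∎)))
        where open ≡-Reasoning

module CycleType where
  open import Data.Empty using (⊥-elim)
  open import Data.Fin as Fin using (Fin; toℕ; _↑ˡ_; _↑ʳ_; splitAt)
  open import Data.Fin.Permutation as Permutation using (Permutation′; permutation; _⟨$⟩ʳ_; _⟨$⟩ˡ_; inverseˡ; inverseʳ; _∘ₚ_)
  open import Data.Nat.Induction using (<-rec)
  import Data.Fin.Properties as Fin
  open import Data.List using (List; []; _∷_)
  open import Data.List.Relation.Unary.All using (All; []; _∷_)
  open import Data.Nat as ℕ using (ℕ; zero; suc; _+_; _≤_; _<_; _<?_; z≤n; s≤s)
  open import Data.Nat.ListAction using (sum)
  open import Data.Nat.Properties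
  open import Data.Product using (Σ; _×_; _,_; proj₁; proj₂)
  open import Data.Sum using (inj₁; inj₂)
  open import Data.Sum.Function.Propositional using (_⊎-↔_)
  open import Function using (_∘_; id)
  open import Function.Construct.Composition using (_↔-∘_)
  open import Function.Construct.Symmetry using (↔-sym)
  open import Relation.Binary.PropositionalEquality
  open import Relation.Nullary using (¬_; Dec; yes; no)
  open FormalPowerSeries +-*-commutativeSemiring using (_⋆_; ⋆-cong; ⋆-congˡ; ⋆-congʳ; geometric; geometricProduct)
  open FixedMonomials

  _⊕_ : ∀ {k m} → Permutation′ k → Permutation′ m → Permutation′ (k + m)
  π ⊕ ρ = ↔-sym Fin.+↔⊎ ↔-∘ ((π ⊎-↔ ρ) ↔-∘ Fin.+↔⊎)

  ⊕-↑ˡ : ∀ {k m} (π : Permutation′ k) (ρ : Permutation′ m) t → (π ⊕ ρ) ⟨$⟩ˡ (t ↑ˡ m) ≡ (π ⟨$⟩ˡ t) ↑ˡ m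
  ⊕-↑ˡ {k} {m} π ρ t rewrite Fin.splitAt-↑ˡ k t m = refl

  ⊕-↑ʳ : ∀ {k m} (π : Permutation′ k) (ρ : Permutation′ m) x → (π ⊕ ρ) ⟨$⟩ˡ (k ↑ʳ x) ≡ k ↑ʳ (ρ ⟨$⟩ˡ x)
  ⊕-↑ʳ {k} {m} π ρ x rewrite Fin.splitAt-↑ʳ k m x = refl

  fixedCount-⊕ : ∀ {k m} (π : Permutation′ k) (ρ : Permutation′ m) →
                 fixedCount ((π ⊕ ρ) ⟨$⟩ˡ_) ≗ fixedCount (π ⟨$⟩ˡ_) ⋆ fixedCount (ρ ⟨$⟩ˡ_)
  fixedCount-⊕ π ρ = fixedCount-blocks {p = (π ⊕ ρ) ⟨$⟩ˡ_} {π ⟨$⟩ˡ_} {ρ ⟨$⟩ˡ_} (⊕-↑ˡ π ρ) (⊕-↑ʳ π ρ)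

  -- The cycle 0 → 1 → ⋯ → a → 0 on Fin (suc a), read in the ⟨$⟩ˡ direction.
  rotation : ∀ a → Permutation′ (suc a)
  rotation a = permutation backward forward backward∘forward forward∘backward
    where
    forward backward : Fin (suc a) → Fin (suc a)
    forward t with toℕ t ℕ.≟ a
    ... | yes _  = Fin.zero
    ... | no t≢a = Fin.suc (Fin.lower₁ t (t≢a ∘ sym))
    backward Fin.zero    = Fin.fromℕ a
    backward (Fin.suc t) = Fin.inject₁ t

    backward∘forward : ∀ t → backward (forward t) ≡ t
    backward∘forward t with toℕ t ℕ.≟ a
    ... | yes t≡a = Fin.toℕ-injective (trans (Fin.toℕ-fromℕ a) (sym t≡a))
    ... | no t≢a  = Fin.inject₁-lower₁ t (t≢a ∘ sym)

    forward∘backward : ∀ t → forward (backward t) ≡ t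
    forward∘backward Fin.zero with toℕ (Fin.fromℕ a) ℕ.≟ a
    ... | yes _ = refl
    ... | no ≢a = ⊥-elim (≢a (Fin.toℕ-fromℕ a))
    forward∘backward (Fin.suc t) with toℕ (Fin.inject₁ t) ℕ.≟ a
    ... | yes ≡a = ⊥-elim (Fin.toℕ-inject₁-≢ t (sym ≡a))
    ... | no ≢a  = cong Fin.suc (Fin.lower₁-inject₁′ t (≢a ∘ sym))

  rotation-path : ∀ a → Path (rotation a ⟨$⟩ˡ_) a
  rotation-path a t t<a with toℕ t ℕ.≟ a
  ... | yes t≡a = ⊥-elim (<-irrefl t≡a t<a)
  ... | no t≢a  = cong suc (Fin.toℕ-lower₁ t (t≢a ∘ sym))

  rotation-last : ∀ a t → toℕ t ≡ a → rotation a ⟨$⟩ˡ t ≡ Fin.zero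
  rotation-last a t t≡a with toℕ t ℕ.≟ a
  ... | yes _  = refl
  ... | no t≢a = ⊥-elim (t≢a t≡a)

  Composition : ℕ → Set
  Composition n = Σ (List ℕ) (λ ps → All (1 ≤_) ps × sum ps ≡ n)

  blockPermutation : ∀ ps → All (1 ≤_) ps → Permutation′ (sum ps)
  blockPermutation []          []          = Permutation.id
  blockPermutation (suc a ∷ ps) (_ ∷ ps≥1) = rotation a ⊕ blockPermutation ps ps≥1

  fixedCount-blockPermutation : ∀ ps ps≥1 → fixedCount (blockPermutation ps ps≥1 ⟨$⟩ˡ_) ≗ geometricProduct ps
  fixedCount-blockPermutation []           []         = fixedCount-empty (Permutation.id ⟨$⟩ˡ_)
  fixedCount-blockPermutation (suc a ∷ ps) (_ ∷ ps≥1) N = begin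
    fixedCount ((rotation a ⊕ blockPermutation ps ps≥1) ⟨$⟩ˡ_) N
      ≡⟨ fixedCount-⊕ (rotation a) (blockPermutation ps ps≥1) N ⟩
    (fixedCount (rotation a ⟨$⟩ˡ_) ⋆ fixedCount (blockPermutation ps ps≥1 ⟨$⟩ˡ_)) N
      ≡⟨ ⋆-cong (fixedCount-cycle (rotation-path a)) (fixedCount-blockPermutation ps ps≥1) N ⟩
    (geometric (suc a) ⋆ geometricProduct ps) N ∎
    where open ≡-Reasoning

  ⟨$⟩ˡ-injective : ∀ {n} (σ : Permutation′ n) {i j} → σ ⟨$⟩ˡ i ≡ σ ⟨$⟩ˡ j → i ≡ j
  ⟨$⟩ˡ-injective σ {i} {j} σi≡σj = trans (sym (inverseʳ σ)) (trans (cong (σ ⟨$⟩ʳ_) σi≡σj) (inverseʳ σ))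

  ↑ˡ≢↑ʳ : ∀ {k m} (t : Fin k) (x : Fin m) → t ↑ˡ m ≢ k ↑ʳ x
  ↑ˡ≢↑ʳ {k} {m} t x t≡x = <-irrefl refl (begin-strict
    toℕ (t ↑ˡ m)   ≡⟨ Fin.toℕ-↑ˡ t m ⟩
    toℕ t          <⟨ Fin.toℕ<n t ⟩
    k              ≤⟨ m≤m+n k (toℕ x) ⟩
    k + toℕ x      ≡⟨ sym (Fin.toℕ-↑ʳ k x) ⟩
    toℕ (k ↑ʳ x)   ≡⟨ cong toℕ (sym t≡x) ⟩
    toℕ (t ↑ˡ m)   ∎)
    where open ≤-Reasoning

  module _ {k m} (σ : Permutation′ (k + m)) (π : Permutation′ k)
           (σ-left : ∀ t → σ ⟨$⟩ˡ (t ↑ˡ m) ≡ (π ⟨$⟩ˡ t) ↑ˡ m) where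

    private
      forward : ∀ x → Σ (Fin m) λ y → σ ⟨$⟩ˡ (k ↑ʳ x) ≡ k ↑ʳ y
      forward x with splitAt k (σ ⟨$⟩ˡ (k ↑ʳ x)) in split
      ... | inj₂ y = y , sym (Fin.splitAt⁻¹-↑ʳ split)
      ... | inj₁ t = ⊥-elim (↑ˡ≢↑ʳ (π ⟨$⟩ʳ t) x (⟨$⟩ˡ-injective σ (begin
        σ ⟨$⟩ˡ ((π ⟨$⟩ʳ t) ↑ˡ m)   ≡⟨ σ-left (π ⟨$⟩ʳ t) ⟩
        (π ⟨$⟩ˡ (π ⟨$⟩ʳ t)) ↑ˡ m   ≡⟨ cong (_↑ˡ m) (inverseˡ π) ⟩
        t ↑ˡ m                     ≡⟨ Fin.splitAt⁻¹-↑ˡ split ⟩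
        σ ⟨$⟩ˡ (k ↑ʳ x)            ∎)))
        where open ≡-Reasoning

      backward : ∀ x → Σ (Fin m) λ y → σ ⟨$⟩ʳ (k ↑ʳ x) ≡ k ↑ʳ y
      backward x with splitAt k (σ ⟨$⟩ʳ (k ↑ʳ x)) in split
      ... | inj₂ y = y , sym (Fin.splitAt⁻¹-↑ʳ split)
      ... | inj₁ t = ⊥-elim (↑ˡ≢↑ʳ (π ⟨$⟩ˡ t) x (begin
        (π ⟨$⟩ˡ t) ↑ˡ m            ≡⟨ sym (σ-left t) ⟩
        σ ⟨$⟩ˡ (t ↑ˡ m)            ≡⟨ cong (σ ⟨$⟩ˡ_) (Fin.splitAt⁻¹-↑ˡ split) ⟩
        σ ⟨$⟩ˡ (σ ⟨$⟩ʳ (k ↑ʳ x))   ≡⟨ inverseˡ σ ⟩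
        k ↑ʳ x                     ∎))
        where open ≡-Reasoning

    restrictʳ : Permutation′ m
    restrictʳ = permutation (proj₁ ∘ backward) (proj₁ ∘ forward)
      (λ x → Fin.↑ʳ-injective k _ _ (begin
        k ↑ʳ proj₁ (backward (proj₁ (forward x))) ≡⟨ sym (proj₂ (backward _)) ⟩
        σ ⟨$⟩ʳ (k ↑ʳ proj₁ (forward x))           ≡⟨ cong (σ ⟨$⟩ʳ_) (sym (proj₂ (forward x))) ⟩
        σ ⟨$⟩ʳ (σ ⟨$⟩ˡ (k ↑ʳ x))                  ≡⟨ inverseʳ σ ⟩
        k ↑ʳ x                                    ∎))
      (λ x → Fin.↑ʳ-injective k _ _ (begin
        k ↑ʳ proj₁ (forward (proj₁ (backward x))) ≡⟨ sym (proj₂ (forward _)) ⟩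
        σ ⟨$⟩ˡ (k ↑ʳ proj₁ (backward x))          ≡⟨ cong (σ ⟨$⟩ˡ_) (sym (proj₂ (backward x))) ⟩
        σ ⟨$⟩ˡ (σ ⟨$⟩ʳ (k ↑ʳ x))                  ≡⟨ inverseˡ σ ⟩
        k ↑ʳ x                                    ∎))
      where open ≡-Reasoning

    restrictʳ-↑ʳ : ∀ x → σ ⟨$⟩ˡ (k ↑ʳ x) ≡ k ↑ʳ (restrictʳ ⟨$⟩ˡ x)
    restrictʳ-↑ʳ x = proj₂ (forward x)

    fixedCount-restrict : fixedCount (σ ⟨$⟩ˡ_) ≗ fixedCount (π ⟨$⟩ˡ_) ⋆ fixedCount (restrictʳ ⟨$⟩ˡ_)
    fixedCount-restrict = fixedCount-blocks {p = σ ⟨$⟩ˡ_} {π ⟨$⟩ˡ_} {restrictʳ ⟨$⟩ˡ_} σ-left restrictʳ-↑ʳ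

  record CycleSplitting {n} (σ : Permutation′ n) : Set where
    field
      a m   : ℕ
      size  : suc a + m ≡ n
      rest  : Permutation′ m
      split : fixedCount (σ ⟨$⟩ˡ_) ≗ geometric (suc a) ⋆ fixedCount (rest ⟨$⟩ˡ_)

  -- σ runs along 0 → 1 → ⋯ → a → 0, so the first a + 1 points form a cycle of σ.
  closedPath-splitting : ∀ {n} a m (size : suc a + m ≡ n) (σ : Permutation′ n) → Path (σ ⟨$⟩ˡ_) a →
                         (∀ t → toℕ t ≡ a → toℕ (σ ⟨$⟩ˡ t) ≡ 0) → CycleSplitting σ
  closedPath-splitting a m refl σ path closes = record
    { a = a ; m = m ; size = refl ; rest = restrictʳ σ (rotation a) σ-left
    ; split = λ N → trans (fixedCount-restrict σ (rotation a) σ-left N)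
                          (⋆-congˡ (fixedCount (restrictʳ σ (rotation a) σ-left ⟨$⟩ˡ_)) (fixedCount-cycle (rotation-path a)) N)
    }
    where
    σ-left : ∀ t → σ ⟨$⟩ˡ (t ↑ˡ m) ≡ (rotation a ⟨$⟩ˡ t) ↑ˡ m
    σ-left t = Fin.toℕ-injective (trans (cases (toℕ t <? a)) (sym (Fin.toℕ-↑ˡ _ m)))
      where
      cases : Dec (toℕ t < a) → toℕ (σ ⟨$⟩ˡ (t ↑ˡ m)) ≡ toℕ (rotation a ⟨$⟩ˡ t)
      cases (yes t<a) = trans (path (t ↑ˡ m) (subst (_< a) (sym (Fin.toℕ-↑ˡ t m)) t<a))
                              (trans (cong suc (Fin.toℕ-↑ˡ t m)) (sym (rotation-path a t t<a)))
      cases (no t≮a)  = trans (closes (t ↑ˡ m) (trans (Fin.toℕ-↑ˡ t m) t≡a)) (cong toℕ (sym (rotation-last a t t≡a)))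
        where
        t≡a : toℕ t ≡ a
        t≡a = ≤-antisym (≤-pred (Fin.toℕ<n t)) (≮⇒≥ t≮a)

  transposition : ∀ {n} → Fin n → Fin n → Fin n → Fin n
  transposition a b x with x Fin.≟ a
  ... | yes _ = b
  ... | no _ with x Fin.≟ b
  ...   | yes _ = a
  ...   | no _  = x

  transposition-a : ∀ {n} (a b : Fin n) → transposition a b a ≡ b
  transposition-a a b with a Fin.≟ a
  ... | yes _  = refl
  ... | no a≢a = ⊥-elim (a≢a refl)

  transposition-b : ∀ {n} (a b : Fin n) → transposition a b b ≡ a
  transposition-b a b with b Fin.≟ a
  ... | yes b≡a = b≡a
  ... | no _ with b Fin.≟ b
  ...   | yes _  = refl
  ...   | no b≢b = ⊥-elim (b≢b refl)

  transposition-other : ∀ {n} (a b x : Fin n) → x ≢ a → x ≢ b → transposition a b x ≡ x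
  transposition-other a b x x≢a x≢b with x Fin.≟ a
  ... | yes x≡a = ⊥-elim (x≢a x≡a)
  ... | no _ with x Fin.≟ b
  ...   | yes x≡b = ⊥-elim (x≢b x≡b)
  ...   | no _    = refl

  transposition-involutive : ∀ {n} (a b x : Fin n) → transposition a b (transposition a b x) ≡ x
  transposition-involutive a b x with x Fin.≟ a
  ... | yes refl = transposition-b x b
  ... | no x≢a with x Fin.≟ b
  ...   | yes refl = transposition-a a x
  ...   | no x≢b   = transposition-other a b x x≢a x≢b

  conjugate : ∀ {n} → Fin n → Fin n → Permutation′ n → Permutation′ n
  conjugate a b σ = τ ∘ₚ σ ∘ₚ τ
    where
    τ : Permutation′ _
    τ = permutation (transposition a b) (transposition a b) (transposition-involutive a b) (transposition-involutive a b)

  fixedCount-conjugate-transposition : ∀ {n} (a b : Fin n) (σ : Permutation′ n) →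
                                       fixedCount (conjugate a b σ ⟨$⟩ˡ_) ≗ fixedCount (σ ⟨$⟩ˡ_)
  fixedCount-conjugate-transposition a b σ =
    fixedCount-conjugate {u = transposition a b} {w = transposition a b}
      (transposition-involutive a b) (transposition-involutive a b) (σ ⟨$⟩ˡ_)

  -- The points 1, …, i are already the images of 0, …, i - 1.
  path-next : ∀ {n} (σ : Permutation′ n) i (c : Fin n) → toℕ c ≡ i → Path (σ ⟨$⟩ˡ_) i →
              toℕ (σ ⟨$⟩ˡ c) ≢ 0 → suc i ≤ toℕ (σ ⟨$⟩ˡ c)
  path-next σ i c c≡i path σc≢0 with toℕ (σ ⟨$⟩ˡ c) in σc≡y
  ... | zero  = ⊥-elim (σc≢0 refl)
  ... | suc s = s≤s (≮⇒≥ s≮i)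
    where
    s≮i : ¬ s < i
    s≮i s<i = <-irrefl (trans (sym (Fin.toℕ-fromℕ< s<n)) (trans (cong toℕ t≡c) c≡i)) s<i
      where
      s<n : s < _
      s<n = <-trans s<i (subst (_< _) c≡i (Fin.toℕ<n c))
      t≡c : Fin.fromℕ< s<n ≡ c
      t≡c = ⟨$⟩ˡ-injective σ (Fin.toℕ-injective (trans (path _ (subst (_< i) (sym (Fin.toℕ-fromℕ< s<n)) s<i))
                                                       (trans (cong suc (Fin.toℕ-fromℕ< s<n)) (sym σc≡y))))

  -- The transposition of i + 1 and y = σ(i) fixes 0, …, i.
  path-extend : ∀ {n} (σ : Permutation′ n) i (c c′ : Fin n) → toℕ c ≡ i → toℕ c′ ≡ suc i → Path (σ ⟨$⟩ˡ_) i →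
                suc i ≤ toℕ (σ ⟨$⟩ˡ c) → Path (conjugate c′ (σ ⟨$⟩ˡ c) σ ⟨$⟩ˡ_) (suc i)
  path-extend σ i c c′ c≡i c′≡1+i path i<y t t≤i = begin
    toℕ (τ (σ ⟨$⟩ˡ τ t)) ≡⟨ cong (λ u → toℕ (τ (σ ⟨$⟩ˡ u))) (τ-fixes t (≤-pred t≤i)) ⟩
    toℕ (τ (σ ⟨$⟩ˡ t))   ≡⟨ step (toℕ t <? i) ⟩
    suc (toℕ t)          ∎
    where
    open ≡-Reasoning
    y : Fin _
    y = σ ⟨$⟩ˡ c
    τ : Fin _ → Fin _
    τ = transposition c′ y
    τ-fixes : ∀ u → toℕ u ≤ i → τ u ≡ u
    τ-fixes u u≤i = transposition-other c′ y u
      (λ u≡c′ → <-irrefl (trans (cong toℕ u≡c′) c′≡1+i) (s≤s u≤i))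
      (λ u≡y → <-irrefl (cong toℕ u≡y) (≤-trans (s≤s u≤i) i<y))
    step : Dec (toℕ t < i) → toℕ (τ (σ ⟨$⟩ˡ t)) ≡ suc (toℕ t)
    step (yes t<i) = trans (cong toℕ (τ-fixes (σ ⟨$⟩ˡ t) (subst (_≤ i) (sym (path t t<i)) t<i))) (path t t<i)
    step (no t≮i)  = begin
      toℕ (τ (σ ⟨$⟩ˡ t)) ≡⟨ cong (λ u → toℕ (τ (σ ⟨$⟩ˡ u))) t≡c ⟩
      toℕ (τ y)          ≡⟨ cong toℕ (transposition-b c′ y) ⟩
      toℕ c′             ≡⟨ c′≡1+i ⟩
      suc i              ≡⟨ cong suc (sym t≡i) ⟩
      suc (toℕ t)        ∎
      where
      t≡i : toℕ t ≡ i
      t≡i = ≤-antisym (≤-pred t≤i) (≮⇒≥ t≮i)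
      t≡c : t ≡ c
      t≡c = Fin.toℕ-injective (trans t≡i (sym c≡i))

  splitting-resp : ∀ {n} {σ β : Permutation′ n} → fixedCount (β ⟨$⟩ˡ_) ≗ fixedCount (σ ⟨$⟩ˡ_) →
                   CycleSplitting β → CycleSplitting σ
  splitting-resp β∼σ s = record { CycleSplitting s ; split = λ N → trans (sym (β∼σ N)) (CycleSplitting.split s N) }

  -- Grow a path 0 → 1 → ⋯ → i inside a conjugate β of σ until it closes into a cycle.
  findCycle : ∀ {n} (σ : Permutation′ n) d i (β : Permutation′ n) → suc i + d ≡ n → Path (β ⟨$⟩ˡ_) i →
              fixedCount (β ⟨$⟩ˡ_) ≗ fixedCount (σ ⟨$⟩ˡ_) → CycleSplitting σ
  findCycle {n} σ d i β size path β∼σ = continue d size (toℕ (β ⟨$⟩ˡ c) ℕ.≟ 0)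
    where
    i<n : i < n
    i<n = subst (i <_) size (s≤s (m≤m+n i d))
    c : Fin n
    c = Fin.fromℕ< i<n
    c≡i : toℕ c ≡ i
    c≡i = Fin.toℕ-fromℕ< i<n

    continue : ∀ d′ → suc i + d′ ≡ n → Dec (toℕ (β ⟨$⟩ˡ c) ≡ 0) → CycleSplitting σ
    continue d′ size′ (yes closes) = splitting-resp β∼σ (closedPath-splitting i d′ size′ β path
      (λ t t≡i → trans (cong (λ u → toℕ (β ⟨$⟩ˡ u)) (Fin.toℕ-injective (trans t≡i (sym c≡i)))) closes))
    continue zero     size′ (no opens) = ⊥-elim (<⇒≱ y<1+i (path-next β i c c≡i path opens))
      where
      y<1+i : toℕ (β ⟨$⟩ˡ c) < suc i
      y<1+i = subst (toℕ (β ⟨$⟩ˡ c) <_) (trans (sym size′) (+-identityʳ (suc i))) (Fin.toℕ<n _)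
    continue (suc d′) size′ (no opens) =
      findCycle σ d′ (suc i) (conjugate c′ (β ⟨$⟩ˡ c) β) (trans (sym (+-suc (suc i) d′)) size′)
        (path-extend β i c c′ c≡i (Fin.toℕ-fromℕ< 1+i<n) path (path-next β i c c≡i path opens))
        (λ N → trans (fixedCount-conjugate-transposition c′ _ β N) (β∼σ N))
      where
      1+i<n : suc i < n
      1+i<n = subst (suc i <_) size′ (s≤s (subst (suc i ≤_) (sym (+-suc i d′)) (s≤s (m≤m+n i d′))))
      c′ : Fin n
      c′ = Fin.fromℕ< 1+i<n

  HasCycleType : ∀ {n} → Permutation′ n → Set
  HasCycleType {n} σ = Σ (Composition n) λ c → fixedCount (σ ⟨$⟩ˡ_) ≗ geometricProduct (proj₁ c)

  cycleType : ∀ n (σ : Permutation′ n) → HasCycleType σ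
  cycleType = <-rec _ step
    where
    step : ∀ n → (∀ {m} → m < n → ∀ (ρ : Permutation′ m) → HasCycleType ρ) → ∀ (σ : Permutation′ n) → HasCycleType σ
    step zero    _   σ = ([] , [] , refl) , fixedCount-empty (σ ⟨$⟩ˡ_)
    step (suc n) rec σ with findCycle σ n 0 σ refl (λ _ ()) (λ _ → refl)
    ... | record { a = a ; m = m ; size = size ; rest = ρ ; split = split } with rec (subst (m <_) size (s≤s (m≤n+m m a))) ρ
    ... | (ps , ps≥1 , ∑ps≡m) , ρ∼ps =
      (suc a ∷ ps , s≤s z≤n ∷ ps≥1 , trans (cong (suc a +_) ∑ps≡m) size) ,
      λ N → trans (split N) (⋆-congʳ (geometric (suc a)) ρ∼ps N)

  realise : ∀ {n} ps → All (1 ≤_) ps → sum ps ≡ n → Σ (Permutation′ n) λ σ → fixedCount (σ ⟨$⟩ˡ_) ≗ geometricProduct ps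
  realise ps ps≥1 refl = blockPermutation ps ps≥1 , fixedCount-blockPermutation ps ps≥1

module Partitions where
  open import Data.Empty using (⊥-elim)
  open import Data.Fin using (Fin)
  open import Data.List as List using (List; []; _∷_; map; concatMap; upTo; length; lookup)
  open import Data.List.Membership.Propositional using (_∈_; lose)
  open import Data.List.Membership.Propositional.Properties using (∈-map⁺; ∈-concatMap⁺; ∈-upTo⁺)
  open import Data.List.Relation.Binary.Permutation.Propositional using (↭-sym)
  open import Data.List.Relation.Binary.Permutation.Propositional.Properties using (All-resp-↭)
  import Data.List.Sort
  open import Data.List.Relation.Unary.All as All using (All; []; _∷_; all?)
  open import Data.List.Relation.Unary.Any as Any using (here; there)
  open import Data.List.Relation.Unary.Any.Properties using (lookup-index)
  open import Data.List.Relation.Unary.Linked using (Linked; linked?)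
  open import Data.Nat using (ℕ; zero; suc; _≤_; _≥_; _≤?_; _≥?_; _≟_; z≤n; s≤s; _!)
  open import Data.Nat.Divisibility using (_∣_; ∣-trans; m∣m*n; m≤n⇒m!∣n!)
  open import Data.Nat.ListAction using (sum)
  open import Data.Nat.ListAction.Properties using (sum-↭)
  open import Data.Nat.Properties
  open import Data.Product using (Σ; ∃; _×_; _,_; proj₁)
  open import Relation.Binary.PropositionalEquality
  import Relation.Binary.Construct.Flip.EqAndOrd as Flip
  open import Relation.Nullary using (Dec; yes; no; _×-dec_)
  open FormalPowerSeries +-*-commutativeSemiring using (_≈ₛ_; geometricProduct; geometricProduct-↭)
  open CycleType using (Composition)
  open Partition

  private
    module Sort = Data.List.Sort (Flip.decTotalOrder ≤-decTotalOrder)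

  sortComposition : ∀ {n} → Composition n → Partition n
  sortComposition (ps , ps≥1 , ∑ps≡n) = record
    { parts       = Sort.sort ps
    ; positive    = All-resp-↭ (↭-sym (Sort.sort-↭ ps)) ps≥1
    ; nonincrease = Sort.sort-↗ ps
    ; total       = trans (sum-↭ (Sort.sort-↭ ps)) ∑ps≡n
    }

  geometricProduct-sortComposition : ∀ {n} (c : Composition n) →
    geometricProduct (parts (sortComposition c)) ≈ₛ geometricProduct (proj₁ c)
  geometricProduct-sortComposition (ps , _) = geometricProduct-↭ (Sort.sort-↭ ps)

  IsPartition : ℕ → List ℕ → Set
  IsPartition n ps = All (1 ≤_) ps × Linked _≥_ ps × sum ps ≡ n

  candidates : ℕ → ℕ → List (List ℕ)
  candidates n zero    = [] ∷ []
  candidates n (suc l) = [] ∷ concatMap (λ a → map (a ∷_) (candidates n l)) (upTo (suc n))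

  ∈-candidates : ∀ n l ps → length ps ≤ l → All (_≤ n) ps → ps ∈ candidates n l
  ∈-candidates n zero    []       _       _          = here refl
  ∈-candidates n (suc l) []       _       _          = here refl
  ∈-candidates n (suc l) (a ∷ ps) (s≤s ∣ps∣≤l) (a≤n ∷ ps≤n) =
    there (∈-concatMap⁺ (λ a → map (a ∷_) (candidates n l))
            (lose (∈-upTo⁺ (s≤s a≤n)) (∈-map⁺ (a ∷_) (∈-candidates n l ps ∣ps∣≤l ps≤n))))

  isPartition? : ∀ n ps → Dec (IsPartition n ps)
  isPartition? n ps = all? (1 ≤?_) ps ×-dec linked? _≥?_ ps ×-dec (sum ps ≟ n)

  selectPartitions : ∀ n → List (List ℕ) → List (Partition n)
  selectPartitions n []          = []
  selectPartitions n (ps ∷ pss) with isPartition? n ps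
  ... | yes (ps≥1 , ps↘ , ∑ps≡n) = record { parts = ps ; positive = ps≥1 ; nonincrease = ps↘ ; total = ∑ps≡n } ∷ selectPartitions n pss
  ... | no _                     = selectPartitions n pss

  ∈-selectPartitions : ∀ n pss ps → ps ∈ pss → IsPartition n ps →
                       ∃ λ (λ′ : Partition n) → λ′ ∈ selectPartitions n pss × parts λ′ ≡ ps
  ∈-selectPartitions n (qs ∷ pss) ps ps∈ isPartition with isPartition? n qs | ps∈
  ... | yes _  | here refl    = _ , here refl , refl
  ... | no ¬qs | here refl    = ⊥-elim (¬qs isPartition)
  ... | yes _  | there ps∈pss with ∈-selectPartitions n pss ps ps∈pss isPartition
  ...   | λ′ , λ′∈ , λ′≡ps = λ′ , there λ′∈ , λ′≡ps
  ∈-selectPartitions n (qs ∷ pss) ps ps∈ isPartition | no _ | there ps∈pss = ∈-selectPartitions n pss ps ps∈pss isPartition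

  partitions : (n : ℕ) → List (Partition n)
  partitions n = selectPartitions n (candidates n n)

  length≤n : ∀ {n} (λ′ : Partition n) → length (parts λ′) ≤ n
  length≤n λ′ = subst (_ ≤_) (total λ′) (length≤sum (parts λ′) (positive λ′))
    where
    length≤sum : ∀ ps → All (1 ≤_) ps → length ps ≤ sum ps
    length≤sum []       []           = z≤n
    length≤sum (a ∷ ps) (a≥1 ∷ ps≥1) = +-mono-≤ a≥1 (length≤sum ps ps≥1)

  parts≤n : ∀ {n} (λ′ : Partition n) → All (_≤ n) (parts λ′)
  parts≤n λ′ = subst (λ m → All (_≤ m) (parts λ′)) (total λ′) (≤sum (parts λ′))
    where
    ≤sum : ∀ ps → All (_≤ sum ps) ps
    ≤sum []       = []
    ≤sum (a ∷ ps) = m≤m+n a (sum ps) ∷ All.map (λ b≤ → ≤-trans b≤ (m≤n+m (sum ps) a)) (≤sum ps)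

  parts∣n! : ∀ {n} (λ′ : Partition n) → All (_∣ n !) (parts λ′)
  parts∣n! λ′ = All.zipWith (λ (a≥1 , a≤n) → ∣-trans (∣! a≥1) (m≤n⇒m!∣n! a≤n)) (positive λ′ , parts≤n λ′)
    where
    ∣! : ∀ {a} → 1 ≤ a → a ∣ a !
    ∣! {suc k} _ = m∣m*n (k !)

  #partitions : ℕ → ℕ
  #partitions n = length (partitions n)

  partitionAt : ∀ n → Fin (#partitions n) → Partition n
  partitionAt n = lookup (partitions n)

  partitionAt-surjective : ∀ {n} (λ′ : Partition n) → Σ (Fin (#partitions n)) λ i → parts (partitionAt n i) ≡ parts λ′
  partitionAt-surjective {n} λ′
    with ∈-selectPartitions n (candidates n n) (parts λ′) (∈-candidates n n (parts λ′) (length≤n λ′) (parts≤n λ′))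
                            (positive λ′ , nonincrease λ′ , total λ′)
  ... | μ , μ∈ , μ≡λ′ = Any.index μ∈ , trans (cong parts (sym (lookup-index μ∈))) μ≡λ′

module FieldArithmetic {c ℓ} (K : Field c ℓ) where
  import Algebra.Solver.Ring
  import Algebra.Solver.Ring.AlmostCommutativeRing as ACR
  open import Data.Empty using (⊥-elim)
  open import Data.Fin using (Fin)
  import Data.Integer as ℤ
  import Data.Integer.Properties as ℤ
  open import Data.Maybe using (Maybe; just; nothing)
  open import Data.Nat as ℕ using (ℕ; zero; suc; _∸_; _≤_)
  import Data.Nat.Properties as ℕ
  open import Data.Product using (Σ; _,_)
  import Data.Sign as Sign
  open import Data.Sum using (inj₁; inj₂)
  open import Function using (_∘_)
  import Relation.Binary.PropositionalEquality as ≡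
  open import Relation.Nullary using (¬_; Dec; yes; no)

  open Field K
  open import Algebra.Properties.Ring ring
    using (-0#≈0#; -‿distribˡ-*; -‿distribʳ-*; -‿involutive; -‿anti-homo-+; -‿+-comm)
  open import Algebra.Properties.Semiring.Sum semiring using (sum)
  open import Relation.Binary.Reasoning.Setoid setoid

  ℕ→K : ℕ → Carrier
  ℕ→K = fromℕ K

  ℕ→K-+ : ∀ m n → ℕ→K (m ℕ.+ n) ≈ ℕ→K m + ℕ→K n
  ℕ→K-+ zero    n = sym (+-identityˡ _)
  ℕ→K-+ (suc m) n = trans (+-congˡ (ℕ→K-+ m n)) (sym (+-assoc _ _ _))

  ℕ→K-* : ∀ m n → ℕ→K (m ℕ.* n) ≈ ℕ→K m * ℕ→K n
  ℕ→K-* zero    n = sym (zeroˡ _)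
  ℕ→K-* (suc m) n = begin
    ℕ→K (n ℕ.+ m ℕ.* n)     ≈⟨ ℕ→K-+ n (m ℕ.* n) ⟩
    ℕ→K n + ℕ→K (m ℕ.* n)   ≈⟨ +-congˡ (ℕ→K-* m n) ⟩
    ℕ→K n + ℕ→K m * ℕ→K n   ≈⟨ sym (trans (distribʳ _ _ _) (+-congʳ (*-identityˡ _))) ⟩
    (1# + ℕ→K m) * ℕ→K n    ∎

  ℕ→K-∸ : ∀ m n → n ≤ m → ℕ→K (m ∸ n) ≈ ℕ→K m - ℕ→K n
  ℕ→K-∸ m n n≤m = begin
    ℕ→K (m ∸ n)                           ≈⟨ sym (+-identityʳ _) ⟩
    ℕ→K (m ∸ n) + 0#                      ≈⟨ +-congˡ (sym (-‿inverseʳ (ℕ→K n))) ⟩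
    ℕ→K (m ∸ n) + (ℕ→K n - ℕ→K n)         ≈⟨ sym (+-assoc _ _ _) ⟩
    ℕ→K (m ∸ n) + ℕ→K n - ℕ→K n           ≈⟨ +-congʳ (sym (ℕ→K-+ (m ∸ n) n)) ⟩
    ℕ→K (m ∸ n ℕ.+ n) - ℕ→K n             ≈⟨ +-congʳ (reflexive (≡.cong ℕ→K (ℕ.m∸n+n≡m n≤m))) ⟩
    ℕ→K m - ℕ→K n                         ∎

  -- The canonical map ℤ → K is a ring morphism, so the ring solver with integer coefficients
  -- applies in K. (With coefficients in K itself the solver cannot cancel x - x, as equality
  -- in K is undecidable.)
  ℤ→K : ℤ.ℤ → Carrier
  ℤ→K (ℤ.+ n)     = ℕ→K n
  ℤ→K ℤ.-[1+ n ] = - ℕ→K (suc n)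

  ℤ→K-neg : ∀ i → ℤ→K (ℤ.- i) ≈ - ℤ→K i
  ℤ→K-neg (ℤ.+ zero)    = sym -0#≈0#
  ℤ→K-neg (ℤ.+ (suc n)) = refl
  ℤ→K-neg ℤ.-[1+ n ]   = sym (-‿involutive _)

  ℤ→K-⊖ : ∀ m n → ℤ→K (m ℤ.⊖ n) ≈ ℕ→K m - ℕ→K n
  ℤ→K-⊖ m n with ℕ.≤-total n m
  ... | inj₁ n≤m = trans (reflexive (≡.cong ℤ→K (ℤ.⊖-≥ n≤m))) (ℕ→K-∸ m n n≤m)
  ... | inj₂ m≤n = begin
    ℤ→K (m ℤ.⊖ n)               ≈⟨ reflexive (≡.cong ℤ→K (ℤ.⊖-≤ m≤n)) ⟩
    ℤ→K (ℤ.- (ℤ.+ (n ∸ m)))     ≈⟨ ℤ→K-neg (ℤ.+ (n ∸ m)) ⟩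
    - ℕ→K (n ∸ m)               ≈⟨ -‿cong (ℕ→K-∸ n m m≤n) ⟩
    - (ℕ→K n - ℕ→K m)           ≈⟨ -‿anti-homo-+ (ℕ→K n) (- ℕ→K m) ⟩
    - - ℕ→K m - ℕ→K n           ≈⟨ +-congʳ (-‿involutive _) ⟩
    ℕ→K m - ℕ→K n               ∎

  ℤ→K-+ : ∀ i j → ℤ→K (i ℤ.+ j) ≈ ℤ→K i + ℤ→K j
  ℤ→K-+ ℤ.-[1+ m ] ℤ.-[1+ n ] = begin
    - ℕ→K (suc (suc (m ℕ.+ n)))   ≈⟨ -‿cong (reflexive (≡.cong (ℕ→K ∘ suc) (≡.sym (ℕ.+-suc m n)))) ⟩
    - ℕ→K (suc m ℕ.+ suc n)       ≈⟨ -‿cong (ℕ→K-+ (suc m) (suc n)) ⟩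
    - (ℕ→K (suc m) + ℕ→K (suc n)) ≈⟨ sym (-‿+-comm _ _) ⟩
    - ℕ→K (suc m) - ℕ→K (suc n)   ∎
  ℤ→K-+ ℤ.-[1+ m ] (ℤ.+ n)    = trans (ℤ→K-⊖ n (suc m)) (+-comm _ _)
  ℤ→K-+ (ℤ.+ m)    ℤ.-[1+ n ] = ℤ→K-⊖ m (suc n)
  ℤ→K-+ (ℤ.+ m)    (ℤ.+ n)    = ℕ→K-+ m n

  ℤ→K-* : ∀ i j → ℤ→K (i ℤ.* j) ≈ ℤ→K i * ℤ→K j
  ℤ→K-* i j = begin
    ℤ→K (ℤ.sign i Sign.* ℤ.sign j ℤ.◃ ℤ.∣ i ∣ ℕ.* ℤ.∣ j ∣)
      ≈⟨ ◃-sign (ℤ.sign i Sign.* ℤ.sign j) (ℤ.∣ i ∣ ℕ.* ℤ.∣ j ∣) ⟩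
    signed (ℤ.sign i Sign.* ℤ.sign j) (ℕ→K (ℤ.∣ i ∣ ℕ.* ℤ.∣ j ∣))
      ≈⟨ signed-cong (ℤ.sign i Sign.* ℤ.sign j) (ℕ→K-* ℤ.∣ i ∣ ℤ.∣ j ∣) ⟩
    signed (ℤ.sign i Sign.* ℤ.sign j) (ℕ→K ℤ.∣ i ∣ * ℕ→K ℤ.∣ j ∣)
      ≈⟨ signed-* (ℤ.sign i) (ℤ.sign j) _ _ ⟩
    signed (ℤ.sign i) (ℕ→K ℤ.∣ i ∣) * signed (ℤ.sign j) (ℕ→K ℤ.∣ j ∣)
      ≈⟨ sym (*-cong (sign-abs i) (sign-abs j)) ⟩
    ℤ→K i * ℤ→K j ∎
    where
    signed : Sign.Sign → Carrier → Carrier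
    signed Sign.+ x = x
    signed Sign.- x = - x
    signed-cong : ∀ s {x y} → x ≈ y → signed s x ≈ signed s y
    signed-cong Sign.+ x≈y = x≈y
    signed-cong Sign.- x≈y = -‿cong x≈y
    ◃-sign : ∀ s n → ℤ→K (s ℤ.◃ n) ≈ signed s (ℕ→K n)
    ◃-sign Sign.+ zero    = refl
    ◃-sign Sign.- zero    = sym -0#≈0#
    ◃-sign Sign.+ (suc n) = refl
    ◃-sign Sign.- (suc n) = refl
    sign-abs : ∀ i → ℤ→K i ≈ signed (ℤ.sign i) (ℕ→K ℤ.∣ i ∣)
    sign-abs (ℤ.+ n)     = refl
    sign-abs ℤ.-[1+ n ] = refl
    signed-* : ∀ s t x y → signed (s Sign.* t) (x * y) ≈ signed s x * signed t y
    signed-* Sign.+ Sign.+ x y = refl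
    signed-* Sign.+ Sign.- x y = -‿distribʳ-* x y
    signed-* Sign.- Sign.+ x y = -‿distribˡ-* x y
    signed-* Sign.- Sign.- x y = trans (sym (-‿involutive _)) (trans (-‿cong (-‿distribˡ-* x y)) (-‿distribʳ-* (- x) y))

  private
    ℤ→K-morphism : ℤ.+-*-rawRing ACR.-Raw-AlmostCommutative⟶ ACR.fromCommutativeRing commutativeRing
    ℤ→K-morphism = record
      { ⟦_⟧ = ℤ→K ; +-homo = ℤ→K-+ ; *-homo = ℤ→K-* ; -‿homo = ℤ→K-neg ; 0-homo = refl ; 1-homo = +-identityʳ 1# }

    coefficient≟ : ∀ i j → Maybe (ℤ→K i ≈ ℤ→K j)
    coefficient≟ i j with i ℤ.≟ j
    ... | yes ≡.refl = just refl
    ... | no _       = nothing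

  module ℤ-Solver = Algebra.Solver.Ring ℤ.+-*-rawRing (ACR.fromCommutativeRing commutativeRing) ℤ→K-morphism coefficient≟
  open ℤ-Solver using (solve; _:+_; _:*_; :-_; _:-_; _:=_)

  x*s≈0⇒x≈0 : ∀ {x s} → ¬ s ≈ 0# → x * s ≈ 0# → x ≈ 0#
  x*s≈0⇒x≈0 {x} {s} s≉0 xs≈0 with inverse s s≉0
  ... | t , st≈1 = begin
    x            ≈⟨ sym (*-identityʳ x) ⟩
    x * 1#       ≈⟨ *-congˡ (sym st≈1) ⟩
    x * (s * t)  ≈⟨ sym (*-assoc x s t) ⟩
    x * s * t    ≈⟨ *-congʳ xs≈0 ⟩
    0# * t       ≈⟨ zeroˡ t ⟩
    0#           ∎

  x≈0⇒x*s≈0 : ∀ {x s} → x ≈ 0# → x * s ≈ 0#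
  x≈0⇒x*s≈0 {x} {s} x≈0 = trans (*-congʳ x≈0) (zeroˡ s)

  y[xs]≈s : ∀ {x y s} → x * y ≈ 1# → y * (x * s) ≈ s
  y[xs]≈s {x} {y} {s} xy≈1 = begin
    y * (x * s) ≈⟨ solve 3 (λ x y s → y :* (x :* s) := x :* y :* s) refl x y s ⟩
    x * y * s   ≈⟨ *-congʳ xy≈1 ⟩
    1# * s      ≈⟨ *-identityˡ s ⟩
    s           ∎

  x-y≈0⇒x≈y : ∀ {x y} → x - y ≈ 0# → x ≈ y
  x-y≈0⇒x≈y {x} {y} x-y≈0 = begin
    x            ≈⟨ solve 2 (λ x y → x := (x :- y) :+ y) refl x y ⟩
    (x - y) + y  ≈⟨ +-congʳ x-y≈0 ⟩
    0# + y       ≈⟨ +-identityˡ y ⟩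
    y            ∎

  -- x = z / (d + 1) for an integer z. In characteristic zero it is decidable whether such an x
  -- is 0, which is what Gaussian elimination needs: equality in K itself is undecidable.
  Rational : Carrier → Set ℓ
  Rational x = Σ ℤ.ℤ λ z → Σ ℕ λ d → x * ℕ→K (suc d) ≈ ℤ→K z

  Rational-resp : ∀ {x y} → x ≈ y → Rational x → Rational y
  Rational-resp x≈y (z , d , eq) = z , d , trans (*-congʳ (sym x≈y)) eq

  Rational-ℕ : ∀ n → Rational (ℕ→K n)
  Rational-ℕ n = ℤ.+ n , 0 , trans (*-congˡ (+-identityʳ 1#)) (*-identityʳ _)

  Rational-+ : ∀ {x y} → Rational x → Rational y → Rational (x + y)
  Rational-+ {x} {y} (z₁ , d₁ , eq₁) (z₂ , d₂ , eq₂) = z₁ ℤ.* ℤ.+ suc d₂ ℤ.+ z₂ ℤ.* ℤ.+ suc d₁ , d₂ ℕ.+ d₁ ℕ.* suc d₂ , (begin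
    (x + y) * ℕ→K (suc d₁ ℕ.* suc d₂)
      ≈⟨ *-congˡ (ℕ→K-* (suc d₁) (suc d₂)) ⟩
    (x + y) * (S₁ * S₂)
      ≈⟨ solve 4 (λ x y S₁ S₂ → (x :+ y) :* (S₁ :* S₂) := x :* S₁ :* S₂ :+ y :* S₂ :* S₁) refl x y S₁ S₂ ⟩
    x * S₁ * S₂ + y * S₂ * S₁
      ≈⟨ +-cong (*-congʳ eq₁) (*-congʳ eq₂) ⟩
    ℤ→K z₁ * S₂ + ℤ→K z₂ * S₁
      ≈⟨ sym (trans (ℤ→K-+ (z₁ ℤ.* ℤ.+ suc d₂) (z₂ ℤ.* ℤ.+ suc d₁)) (+-cong (ℤ→K-* z₁ (ℤ.+ suc d₂)) (ℤ→K-* z₂ (ℤ.+ suc d₁)))) ⟩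
    ℤ→K (z₁ ℤ.* ℤ.+ suc d₂ ℤ.+ z₂ ℤ.* ℤ.+ suc d₁) ∎)
    where
    S₁ S₂ : Carrier
    S₁ = ℕ→K (suc d₁)
    S₂ = ℕ→K (suc d₂)

  Rational-* : ∀ {x y} → Rational x → Rational y → Rational (x * y)
  Rational-* {x} {y} (z₁ , d₁ , eq₁) (z₂ , d₂ , eq₂) = z₁ ℤ.* z₂ , d₂ ℕ.+ d₁ ℕ.* suc d₂ , (begin
    x * y * ℕ→K (suc d₁ ℕ.* suc d₂)  ≈⟨ *-congˡ (ℕ→K-* (suc d₁) (suc d₂)) ⟩
    x * y * (S₁ * S₂)                ≈⟨ solve 4 (λ x y S₁ S₂ → x :* y :* (S₁ :* S₂) := x :* S₁ :* (y :* S₂)) refl x y S₁ S₂ ⟩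
    x * S₁ * (y * S₂)                ≈⟨ *-cong eq₁ eq₂ ⟩
    ℤ→K z₁ * ℤ→K z₂                  ≈⟨ sym (ℤ→K-* z₁ z₂) ⟩
    ℤ→K (z₁ ℤ.* z₂)                  ∎)
    where
    S₁ S₂ : Carrier
    S₁ = ℕ→K (suc d₁)
    S₂ = ℕ→K (suc d₂)

  Rational-neg : ∀ {x} → Rational x → Rational (- x)
  Rational-neg {x} (z , d , eq) = ℤ.- z , d , trans (sym (-‿distribˡ-* x _)) (trans (-‿cong eq) (sym (ℤ→K-neg z)))

  Rational-sum : ∀ {d} (f : Fin d → Carrier) → (∀ j → Rational (f j)) → Rational (sum f)
  Rational-sum {zero}  f _         = Rational-ℕ 0
  Rational-sum {suc d} f rational = Rational-+ (rational Fin.zero) (Rational-sum (f ∘ Fin.suc) (rational ∘ Fin.suc))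
    where import Data.Fin as Fin

  module _ (charZero : CharZero K) where

    Rational-zero? : ∀ {x} → Rational x → Dec (x ≈ 0#)
    Rational-zero? {x} (ℤ.+ zero    , d , eq) = yes (x*s≈0⇒x≈0 (charZero d) eq)
    Rational-zero? {x} (ℤ.+ (suc k) , d , eq) = no λ x≈0 → charZero k (trans (sym eq) (x≈0⇒x*s≈0 x≈0))
    Rational-zero? {x} (ℤ.-[1+ k ]  , d , eq) = no λ x≈0 → charZero k (begin
      ℕ→K (suc k)     ≈⟨ sym (-‿involutive _) ⟩
      - - ℕ→K (suc k) ≈⟨ -‿cong (trans (sym eq) (x≈0⇒x*s≈0 x≈0)) ⟩
      - 0#            ≈⟨ -0#≈0# ⟩
      0#              ∎)

    Rational-inverse : ∀ {x y} → x * y ≈ 1# → Rational x → Rational y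
    Rational-inverse {x} {y} xy≈1 (ℤ.+ zero , d , eq) = ⊥-elim (1≉0 (begin
      1#     ≈⟨ sym xy≈1 ⟩
      x * y  ≈⟨ *-congʳ (x*s≈0⇒x≈0 (charZero d) eq) ⟩
      0# * y ≈⟨ zeroˡ y ⟩
      0#     ∎))
    Rational-inverse {x} {y} xy≈1 (ℤ.+ (suc k) , d , eq) = ℤ.+ suc d , k , (begin
      y * ℕ→K (suc k)        ≈⟨ *-congˡ (sym eq) ⟩
      y * (x * ℕ→K (suc d))  ≈⟨ y[xs]≈s xy≈1 ⟩
      ℕ→K (suc d)            ∎)
    Rational-inverse {x} {y} xy≈1 (ℤ.-[1+ k ] , d , eq) = ℤ.-[1+ d ] , k , (begin
      y * ℕ→K (suc k)            ≈⟨ sym (-‿involutive _) ⟩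
      - - (y * ℕ→K (suc k))      ≈⟨ -‿cong (-‿distribʳ-* y _) ⟩
      - (y * - ℕ→K (suc k))      ≈⟨ -‿cong (*-congˡ (sym eq)) ⟩
      - (y * (x * ℕ→K (suc d)))  ≈⟨ -‿cong (y[xs]≈s xy≈1) ⟩
      - ℕ→K (suc d)              ∎)

module FieldPowerSeries {c ℓ} (K : Field c ℓ) where
  open import Data.Bool using (true; false; if_then_else_)
  open import Data.Empty using (⊥-elim)
  open import Data.Fin using (Fin)
  open import Data.List using (List; []; _∷_; map; applyUpTo; length)
  open import Data.List.Relation.Unary.All using (All; []; _∷_)
  open import Data.Nat as ℕ using (ℕ; zero; suc; _∸_; _≤_; _<_; z≤n; s≤s)
  open import Data.Nat.Divisibility using (_∣_; _∣?_; ∣m∸n∣n⇒∣m; ∣m+n∣m⇒∣n; ∣-refl; _∣0; ∣⇒≤)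
  import Data.Nat.Properties as ℕ
  open import Function using (_∘_)
  import Relation.Binary.PropositionalEquality as ≡
  open import Relation.Nullary using (yes; no; ⌊_⌋)

  open Field K
  open FieldArithmetic K using (ℕ→K; ℕ→K-+; ℕ→K-*)
  open import Algebra.Properties.Ring ring using (-1*x≈-x; -0#≈0#; -‿distribˡ-*)
  open import Relation.Binary.Reasoning.Setoid setoid
  open FormalPowerSeries commutativeSemiring public
  module ℕ-Series = FormalPowerSeries ℕ.+-*-commutativeSemiring

  sumK-applyUpTo : ∀ (h : ℕ → Carrier) s N → sumK K (map h (applyUpTo s (suc N))) ≈ ∑≤ N (h ∘ s)
  sumK-applyUpTo h s zero    = +-identityʳ _
  sumK-applyUpTo h s (suc N) = +-congˡ (sumK-applyUpTo h (s ∘ suc) N)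

  fλ≈geometricProduct : ∀ ps → fλ K ps ≈ₛ geometricProduct ps
  fλ≈geometricProduct []       zero    = refl
  fλ≈geometricProduct []       (suc N) = refl
  fλ≈geometricProduct (p ∷ ps) N =
    trans (sumK-applyUpTo (λ i → geom K p i * fλ K ps (N ∸ i)) (λ i → i) N) (⋆-congʳ (geometric p) (fλ≈geometricProduct ps) N)

  ℕ→K-∑≤ : ∀ N f → ℕ→K (ℕ-Series.∑≤ N f) ≈ ∑≤ N (ℕ→K ∘ f)
  ℕ→K-∑≤ zero    f = refl
  ℕ→K-∑≤ (suc N) f = trans (ℕ→K-+ (f 0) _) (+-congˡ (ℕ→K-∑≤ N (f ∘ suc)))

  ℕ→K-⋆ : ∀ f g N → ℕ→K ((f ℕ-Series.⋆ g) N) ≈ ((ℕ→K ∘ f) ⋆ (ℕ→K ∘ g)) N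
  ℕ→K-⋆ f g N = trans (ℕ→K-∑≤ N _) (∑≤-cong N (λ i _ → ℕ→K-* (f i) (g (N ∸ i))))

  ℕ→K-if : ∀ b → ℕ→K (if b then 1 else 0) ≈ (if b then 1# else 0#)
  ℕ→K-if true  = +-identityʳ 1#
  ℕ→K-if false = refl

  ℕ→K-geometricProduct : ∀ ps → (ℕ→K ∘ ℕ-Series.geometricProduct ps) ≈ₛ geometricProduct ps
  ℕ→K-geometricProduct []       N = ℕ→K-if (0 ℕ.≡ᵇ N)
  ℕ→K-geometricProduct (p ∷ ps) N =
    trans (ℕ→K-⋆ (ℕ-Series.geometric p) (ℕ-Series.geometricProduct ps) N)
          (⋆-cong (λ i → ℕ→K-if ⌊ p ∣? i ⌋) (ℕ→K-geometricProduct ps) N)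

  ∑≤-neg : ∀ N f → ∑≤ N (λ i → - f i) ≈ - ∑≤ N f
  ∑≤-neg N f = begin
    ∑≤ N (λ i → - f i)      ≈⟨ ∑≤-cong N (λ i _ → sym (-1*x≈-x (f i))) ⟩
    ∑≤ N (λ i → - 1# * f i) ≈⟨ ∑≤-*ˡ N (- 1#) f ⟩
    - 1# * ∑≤ N f           ≈⟨ -1*x≈-x _ ⟩
    - ∑≤ N f                ∎

  module _ (L : ℕ) (1≤L : 1 ≤ L) where

    1-q^L : Series
    1-q^L N = monomial 0 N - monomial L N

    D : Series → Series
    D h = 1-q^L ⋆ h

    D-cong : ∀ {h h′} → h ≈ₛ h′ → D h ≈ₛ D h′
    D-cong = ⋆-congʳ _

    D-eval : ∀ h N → D h N ≈ h N - (monomial L ⋆ h) N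
    D-eval h N = begin
      ∑≤ N (λ i → (monomial 0 i - monomial L i) * h (N ∸ i))
        ≈⟨ ∑≤-cong N (λ i _ → trans (distribʳ _ _ _) (+-congˡ (sym (-‿distribˡ-* _ _)))) ⟩
      ∑≤ N (λ i → monomial 0 i * h (N ∸ i) + - (monomial L i * h (N ∸ i)))
        ≈⟨ ∑≤-+ N _ _ ⟩
      (monomial 0 ⋆ h) N + ∑≤ N (λ i → - (monomial L i * h (N ∸ i)))
        ≈⟨ +-cong (⋆-identityˡ h N) (∑≤-neg N _) ⟩
      h N - (monomial L ⋆ h) N ∎

    D-geometric : ∀ {a} → a ∣ L → VanishesFrom L (D (geometric a))
    D-geometric {a} a∣L N L≤N = begin
      D (geometric a) N                          ≈⟨ D-eval (geometric a) N ⟩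
      geometric a N - (monomial L ⋆ geometric a) N ≈⟨ +-congˡ (-‿cong (monomial-⋆ L (geometric a) N L≤N)) ⟩
      geometric a N - geometric a (N ∸ L)        ≈⟨ +-congˡ (-‿cong (reflexive (≡.cong (λ b → if b then 1# else 0#) a∣N⇔a∣N-L))) ⟩
      geometric a N - geometric a N              ≈⟨ -‿inverseʳ _ ⟩
      0#                                         ∎
      where
      a∣N⇔a∣N-L : ⌊ a ∣? (N ∸ L) ⌋ ≡.≡ ⌊ a ∣? N ⌋
      a∣N⇔a∣N-L with a ∣? (N ∸ L) | a ∣? N
      ... | yes _      | yes _    = ≡.refl
      ... | no  _      | no _     = ≡.refl
      ... | yes a∣N-L  | no a∤N   = ⊥-elim (a∤N (∣m∸n∣n⇒∣m a L≤N a∣N-L a∣L))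
      ... | no  a∤N-L  | yes a∣N  = ⊥-elim (a∤N-L (∣m+n∣m⇒∣n (≡.subst (a ∣_) (≡.sym (ℕ.m+[n∸m]≡n L≤N)) a∣N) a∣L))

    1-q^L-vanishes : VanishesFrom (suc L) 1-q^L
    1-q^L-vanishes N L<N = begin
      monomial 0 N - monomial L N ≈⟨ +-cong (monomial-≢ (λ 0≡N → ℕ.<⇒≢ (ℕ.<-≤-trans (s≤s z≤n) L<N) 0≡N))
                                            (-‿cong (monomial-≢ (ℕ.<⇒≢ L<N))) ⟩
      0# - 0#                     ≈⟨ -‿inverseʳ 0# ⟩
      0#                          ∎

    geometric-D : D (geometric L) ≈ₛ monomial 0
    geometric-D N with L ℕ.≤? N
    ... | yes L≤N = trans (D-geometric ∣-refl N L≤N) (sym (monomial-≢ (λ 0≡N → ℕ.<⇒≢ (ℕ.<-≤-trans 1≤L L≤N) 0≡N)))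
    ... | no L≰N = begin
      D (geometric L) N                             ≈⟨ D-eval (geometric L) N ⟩
      geometric L N - (monomial L ⋆ geometric L) N  ≈⟨ +-congˡ (-‿cong (monomial-⋆-below L (geometric L) N (ℕ.≰⇒> L≰N))) ⟩
      geometric L N - 0#                            ≈⟨ trans (+-congˡ -0#≈0#) (+-identityʳ _) ⟩
      geometric L N                                 ≈⟨ below N (ℕ.≰⇒> L≰N) ⟩
      monomial 0 N                                  ∎
      where
      below : ∀ N → N < L → geometric L N ≈ monomial 0 N
      below zero    _   with L ∣? 0
      ... | yes _   = refl
      ... | no L∤0  = ⊥-elim (L∤0 (L ∣0))
      below (suc N) 1+N<L with L ∣? suc N
      ... | no _    = refl
      ... | yes L∣N = ⊥-elim (ℕ.<⇒≱ 1+N<L (∣⇒≤ L∣N))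

    D-injective : ∀ {h} → D h ≈ₛ (λ _ → 0#) → h ≈ₛ (λ _ → 0#)
    D-injective {h} Dh≈0 N = begin
      h N                                ≈⟨ sym (⋆-identityˡ h N) ⟩
      (monomial 0 ⋆ h) N                 ≈⟨ ⋆-congˡ h (λ M → trans (sym (geometric-D M)) (⋆-comm 1-q^L (geometric L) M)) N ⟩
      ((geometric L ⋆ 1-q^L) ⋆ h) N      ≈⟨ ⋆-assoc (geometric L) 1-q^L h N ⟩
      (geometric L ⋆ D h) N              ≈⟨ ⋆-congʳ (geometric L) Dh≈0 N ⟩
      (geometric L ⋆ (λ _ → 0#)) N       ≈⟨ ∑≤-zero N (λ i _ → zeroʳ _) ⟩
      0#                                 ∎

    Dⁿ : ℕ → Series → Series
    Dⁿ zero    h = h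
    Dⁿ (suc j) h = D (Dⁿ j h)

    Dⁿ-injective : ∀ j {h} → Dⁿ j h ≈ₛ (λ _ → 0#) → h ≈ₛ (λ _ → 0#)
    Dⁿ-injective zero    h≈0  = h≈0
    Dⁿ-injective (suc j) Dh≈0 = Dⁿ-injective j (D-injective Dh≈0)

    Dⁿ-⋆ : ∀ j f g → Dⁿ j (f ⋆ g) ≈ₛ f ⋆ Dⁿ j g
    Dⁿ-⋆ zero    f g N = refl
    Dⁿ-⋆ (suc j) f g N = trans (D-cong (Dⁿ-⋆ j f g) N) (⋆-swap 1-q^L f (Dⁿ j g) N)

    Dⁿ-∑ : ∀ j {d} (a : Fin d → Carrier) (g : Fin d → Series) →
           Dⁿ j (λ N → ∑[ l < d ] (a l * g l N)) ≈ₛ (λ N → ∑[ l < d ] (a l * Dⁿ j (g l) N))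
    Dⁿ-∑ zero    a g N = refl
    Dⁿ-∑ (suc j) a g N = trans (D-cong (Dⁿ-∑ j a g) N) (⋆-∑ 1-q^L a (Dⁿ j ∘ g) N)

    Dⁿ-vanishesBelow : ∀ j {s h} → VanishesBelow s h → VanishesBelow s (Dⁿ j h)
    Dⁿ-vanishesBelow zero    h≈0 = h≈0
    Dⁿ-vanishesBelow (suc j) h≈0 = ⋆-vanishesBelow 1-q^L (Dⁿ-vanishesBelow j h≈0)

    -- Each factor (1 - q ^ L) / (1 - q ^ p) with p ∣ L is a polynomial of degree < L.
    Dⁿ-geometricProduct : ∀ j ps → length ps ≤ j → All (_∣ L) ps → VanishesFrom (j ℕ.* suc L ℕ.+ 1) (Dⁿ j (geometricProduct ps))
    Dⁿ-geometricProduct zero    []       _ _ N 1≤N = monomial-≢ (λ 0≡N → ℕ.<⇒≢ 1≤N 0≡N)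
    Dⁿ-geometricProduct (suc j) []       _ _ = vanishesFrom-mono (ℕ.≤-reflexive (≡.sym (ℕ.+-assoc (suc L) (j ℕ.* suc L) 1)))
      (⋆-vanishesFrom 1-q^L-vanishes (Dⁿ-geometricProduct j [] z≤n []))
    Dⁿ-geometricProduct (suc j) (p ∷ ps) (s≤s |ps|≤j) (p∣L ∷ ps∣L) =
      vanishesFrom-resp (λ N → trans (D-cong (Dⁿ-⋆ j (geometric p) (geometricProduct ps)) N)
                                     (sym (⋆-assoc 1-q^L (geometric p) (Dⁿ j (geometricProduct ps)) N)))
        (vanishesFrom-mono (ℕ.≤-trans (ℕ.+-monoˡ-≤ _ (ℕ.n≤1+n L)) (ℕ.≤-reflexive (≡.sym (ℕ.+-assoc (suc L) (j ℕ.* suc L) 1))))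
          (⋆-vanishesFrom (D-geometric p∣L) (Dⁿ-geometricProduct j ps |ps|≤j ps∣L)))

    -- Dⁿ n of the combination vanishes inside the window because the combination does, and
    -- beyond it by Dⁿ-geometricProduct; then D is injective.
    geometricProducts-window : ∀ n {d} (a : Fin d → Carrier) (pss : Fin d → List ℕ) →
      (∀ l → length (pss l) ≤ n) → (∀ l → All (_∣ L) (pss l)) →
      VanishesBelow (n ℕ.* suc L ℕ.+ 1) (λ N → ∑[ l < d ] (a l * geometricProduct (pss l) N)) →
      (λ N → ∑[ l < d ] (a l * geometricProduct (pss l) N)) ≈ₛ (λ _ → 0#)
    geometricProducts-window n a pss short divides G≈0 = Dⁿ-injective n DⁿG≈0
      where
      DⁿG≈0 : Dⁿ n (λ N → ∑[ l < _ ] (a l * geometricProduct (pss l) N)) ≈ₛ (λ _ → 0#)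
      DⁿG≈0 N with N ℕ.<? n ℕ.* suc L ℕ.+ 1
      ... | yes N<B = Dⁿ-vanishesBelow n G≈0 N N<B
      ... | no N≮B  = trans (Dⁿ-∑ n a (geometricProduct ∘ pss) N)
        (sum-zero (λ l → trans (*-congˡ (Dⁿ-geometricProduct n (pss l) (short l) (divides l) N (ℕ.≮⇒≥ N≮B))) (zeroʳ _)))

module LinearAlgebra {c ℓ} (K : Field c ℓ) where
  open import Data.Bool using (if_then_else_)
  open import Data.Empty using (⊥-elim)
  open import Data.Fin as Fin using (Fin; zero; suc)
  import Data.Fin.Properties as Fin
  open import Data.Nat as ℕ using (ℕ)
  open import Data.Product using (Σ; ∃; _×_; _,_; proj₁; proj₂)
  open import Data.Vec.Functional using (_∷_)
  open import Function using (_∘_)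
  open import Level using (_⊔_)
  import Relation.Binary.PropositionalEquality as ≡
  open import Relation.Nullary using (¬_; Dec; yes; no; ⌊_⌋; ¬?)

  open Field K hiding (zero)
  open FieldArithmetic K
  open ℤ-Solver using (solve; _:+_; _:*_; :-_; _:-_; _:=_)
  open import Algebra.Properties.Ring ring using (-1*x≈-x; -0#≈0#; -‿distribˡ-*)
  open import Algebra.Properties.Semiring.Sum semiring using (∑-comm; *-distribʳ-sum)
  open import Algebra.Properties.CommutativeSemigroup *-commutativeSemigroup using (x∙yz≈y∙xz)
  open FormalPowerSeries commutativeSemiring using (sum; sum-syntax; sum-cong-≋; ∑-distrib-+; *-distribˡ-sum; sum-zero)
  open import Relation.Binary.Reasoning.Setoid setoid

  ∑-neg : ∀ {d} (f : Fin d → Carrier) → ∑[ l < d ] (- f l) ≈ - sum f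
  ∑-neg f = trans (sum-cong-≋ (λ l → sym (-1*x≈-x (f l))))
                  (trans (sym (*-distribˡ-sum (- 1#) f)) (-1*x≈-x _))

  ∑-∑-* : ∀ {d e} (a : Fin e → Carrier) (b : Fin e → Fin d → Carrier) (f : Fin d → Carrier) →
          ∑[ k < e ] (a k * ∑[ l < d ] (b k l * f l)) ≈ ∑[ l < d ] (∑[ k < e ] (a k * b k l) * f l)
  ∑-∑-* a b f = begin
    ∑[ k < _ ] (a k * ∑[ l < _ ] (b k l * f l))     ≈⟨ sum-cong-≋ (λ k → *-distribˡ-sum (a k) (λ l → b k l * f l)) ⟩
    ∑[ k < _ ] ∑[ l < _ ] (a k * (b k l * f l))     ≈⟨ ∑-comm (λ k l → a k * (b k l * f l)) ⟩
    ∑[ l < _ ] ∑[ k < _ ] (a k * (b k l * f l))     ≈⟨ sum-cong-≋ (λ l → trans (sum-cong-≋ (λ k → sym (*-assoc (a k) (b k l) (f l))))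
                                                                             (sym (*-distribʳ-sum (f l) (λ k → a k * b k l)))) ⟩
    ∑[ l < _ ] (∑[ k < _ ] (a k * b k l) * f l)     ∎

  ∑-∑-swap : ∀ {d e} (a : Fin d → Carrier) (b : Fin e → Carrier) (m : Fin d → Fin e → Carrier) →
             ∑[ j < d ] (a j * ∑[ l < e ] (b l * m j l)) ≈ ∑[ l < e ] (b l * ∑[ j < d ] (a j * m j l))
  ∑-∑-swap a b m = begin
    ∑[ j < _ ] (a j * ∑[ l < _ ] (b l * m j l))   ≈⟨ sum-cong-≋ (λ j → *-distribˡ-sum (a j) (λ l → b l * m j l)) ⟩
    ∑[ j < _ ] ∑[ l < _ ] (a j * (b l * m j l))   ≈⟨ ∑-comm (λ j l → a j * (b l * m j l)) ⟩
    ∑[ l < _ ] ∑[ j < _ ] (a j * (b l * m j l))   ≈⟨ sum-cong-≋ (λ l → sum-cong-≋ (λ j → x∙yz≈y∙xz (a j) (b l) (m j l))) ⟩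
    ∑[ l < _ ] ∑[ j < _ ] (b l * (a j * m j l))   ≈⟨ sum-cong-≋ (λ l → sym (*-distribˡ-sum (b l) (λ j → a j * m j l))) ⟩
    ∑[ l < _ ] (b l * ∑[ j < _ ] (a j * m j l))   ∎

  δ : ∀ {r} → Fin r → Fin r → Carrier
  δ k l = if ⌊ k Fin.≟ l ⌋ then 1# else 0#

  δ-suc : ∀ {r} (k l : Fin r) → δ (suc k) (suc l) ≈ δ k l
  δ-suc k l with k Fin.≟ l
  ... | yes _ = refl
  ... | no _  = refl

  ∑-δ : ∀ {r} (f : Fin r → Carrier) l → ∑[ k < r ] (f k * δ k l) ≈ f l
  ∑-δ f zero = begin
    f zero * 1# + ∑[ k < _ ] (f (suc k) * 0#) ≈⟨ +-cong (*-identityʳ _) (sum-zero (λ k → zeroʳ (f (suc k)))) ⟩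
    f zero + 0#                               ≈⟨ +-identityʳ _ ⟩
    f zero                                    ∎
  ∑-δ f (suc l) = begin
    f zero * 0# + ∑[ k < _ ] (f (suc k) * δ (suc k) (suc l)) ≈⟨ +-cong (zeroʳ _) (sum-cong-≋ (λ k → *-congˡ (δ-suc k l))) ⟩
    0# + ∑[ k < _ ] (f (suc k) * δ k l)                      ≈⟨ +-identityˡ _ ⟩
    ∑[ k < _ ] (f (suc k) * δ k l)                           ≈⟨ ∑-δ (f ∘ suc) l ⟩
    f (suc l)                                                ∎

  ∑-δˡ : ∀ {r} (f : Fin r → Carrier) l → ∑[ k < r ] (δ l k * f k) ≈ f l
  ∑-δˡ f l = trans (sum-cong-≋ (λ k → trans (*-comm _ _) (*-congˡ (δ-sym l k)))) (∑-δ f l)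
    where
    δ-sym : ∀ {r} (k l : Fin r) → δ k l ≈ δ l k
    δ-sym k l with k Fin.≟ l | l Fin.≟ k
    ... | yes _   | yes _   = refl
    ... | no _    | no _    = refl
    ... | yes k≡l | no l≢k  = ⊥-elim (l≢k (≡.sym k≡l))
    ... | no k≢l  | yes l≡k = ⊥-elim (k≢l (≡.sym l≡k))

  lincomb≡∑ : ∀ {d a} {X : Set a} (cs : Fin d → Carrier) (w : Fin d → X → Carrier) x →
              lincomb K cs w x ≡.≡ ∑[ j < d ] (cs j * w j x)
  lincomb≡∑ {ℕ.zero}  cs w x = ≡.refl
  lincomb≡∑ {ℕ.suc d} cs w x = ≡.cong (cs zero * w zero x +_) (lincomb≡∑ (cs ∘ suc) (w ∘ suc) x)

  lincomb-cong : ∀ {d a b} {X : Set a} {Y : Set b} (cs : Fin d → Carrier) (v : Fin d → X → Carrier) (u : Fin d → Y → Carrier) {x y} →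
                 (∀ j → v j x ≈ u j y) → lincomb K cs v x ≈ lincomb K cs u y
  lincomb-cong cs v u {x} {y} v≈u = begin
    lincomb K cs v x           ≡⟨ lincomb≡∑ cs v x ⟩
    ∑[ j < _ ] (cs j * v j x)  ≈⟨ sum-cong-≋ (λ j → *-congˡ (v≈u j)) ⟩
    ∑[ j < _ ] (cs j * u j y)  ≡⟨ lincomb≡∑ cs u y ⟨
    lincomb K cs u y           ∎

  module Span {a} {X : Set a} {d} (w : Fin d → X → Carrier) where

    coefficients : ∀ {u} → InSpan K w u → Fin d → Carrier
    coefficients = proj₁

    expansion : ∀ {u} (s : InSpan K w u) x → ∑[ j < d ] (coefficients s j * w j x) ≈ u x
    expansion (cs , eq) x = trans (reflexive (≡.sym (lincomb≡∑ cs w x))) (eq x)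

    inSpan : ∀ {u} (cs : Fin d → Carrier) → (∀ x → ∑[ j < d ] (cs j * w j x) ≈ u x) → InSpan K w u
    inSpan cs eq = cs , λ x → trans (reflexive (lincomb≡∑ cs w x)) (eq x)

    linIndep : (∀ cs → (∀ x → ∑[ j < d ] (cs j * w j x) ≈ 0#) → ∀ j → cs j ≈ 0#) → LinIndep K w
    linIndep indep cs eq = indep cs (λ x → trans (reflexive (≡.sym (lincomb≡∑ cs w x))) (eq x))

    independence : LinIndep K w → ∀ cs → (∀ x → ∑[ j < d ] (cs j * w j x) ≈ 0#) → ∀ j → cs j ≈ 0#
    independence indep cs eq = indep cs (λ x → trans (reflexive (lincomb≡∑ cs w x)) (eq x))

    member : ∀ j → InSpan K w (w j)
    member j = inSpan (δ j) (λ x → ∑-δˡ (λ k → w k x) j)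

    resp : ∀ {u u′} → (∀ x → u x ≈ u′ x) → InSpan K w u → InSpan K w u′
    resp u≈u′ (cs , eq) = cs , λ x → trans (eq x) (u≈u′ x)

    linear : ∀ {u u′} α β → InSpan K w u → InSpan K w u′ → InSpan K w (λ x → α * u x + β * u′ x)
    linear {u} {u′} α β s s′ = inSpan (λ j → α * coefficients s j + β * coefficients s′ j) λ x → begin
      ∑[ j < d ] ((α * coefficients s j + β * coefficients s′ j) * w j x)
        ≈⟨ sum-cong-≋ (λ j → trans (distribʳ (w j x) (α * coefficients s j) (β * coefficients s′ j))
                                           (+-cong (*-assoc α _ (w j x)) (*-assoc β _ (w j x)))) ⟩
      ∑[ j < d ] (α * (coefficients s j * w j x) + β * (coefficients s′ j * w j x))
        ≈⟨ ∑-distrib-+ (λ j → α * (coefficients s j * w j x)) (λ j → β * (coefficients s′ j * w j x)) ⟩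
      ∑[ j < d ] (α * (coefficients s j * w j x)) + ∑[ j < d ] (β * (coefficients s′ j * w j x))
        ≈⟨ +-cong (sym (*-distribˡ-sum α (λ j → coefficients s j * w j x))) (sym (*-distribˡ-sum β (λ j → coefficients s′ j * w j x))) ⟩
      α * ∑[ j < d ] (coefficients s j * w j x) + β * ∑[ j < d ] (coefficients s′ j * w j x)
        ≈⟨ +-cong (*-congˡ (expansion s x)) (*-congˡ (expansion s′ x)) ⟩
      α * u x + β * u′ x ∎

    ∑-closed : ∀ {e} (α : Fin e → Carrier) (u : Fin e → X → Carrier) → (∀ k → InSpan K w (u k)) →
               InSpan K w (λ x → ∑[ k < e ] (α k * u k x))
    ∑-closed α u s = inSpan (λ j → ∑[ k < _ ] (α k * coefficients (s k) j))
      (λ x → trans (sym (∑-∑-* α (λ k j → coefficients (s k) j) (λ j → w j x))) (sum-cong-≋ (λ k → *-congˡ (expansion (s k) x))))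

  InSpan-tail : ∀ {a} {X : Set a} {d} (w : Fin (ℕ.suc d) → X → Carrier) {u} → InSpan K (w ∘ suc) u → InSpan K w u
  InSpan-tail w (cs , eq) = (0# ∷ cs) , λ x → trans (+-congʳ (zeroˡ _)) (trans (+-identityˡ _) (eq x))

  ∑-*-sub : ∀ {d} (a b e : Fin d → Carrier) w → ∑[ k < d ] (a k * (b k - e k * w)) ≈ sum (λ k → a k * b k) - sum (λ k → a k * e k) * w
  ∑-*-sub a b e w = begin
    ∑[ k < _ ] (a k * (b k - e k * w))
      ≈⟨ sum-cong-≋ (λ k → solve 4 (λ a b e w → a :* (b :- e :* w) := a :* b :+ :- (a :* e :* w)) refl (a k) (b k) (e k) w) ⟩
    ∑[ k < _ ] (a k * b k + - (a k * e k * w))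
      ≈⟨ ∑-distrib-+ (λ k → a k * b k) (λ k → - (a k * e k * w)) ⟩
    sum (λ k → a k * b k) + ∑[ k < _ ] (- (a k * e k * w))
      ≈⟨ +-congˡ (trans (∑-neg (λ k → a k * e k * w)) (-‿cong (sym (*-distribʳ-sum w (λ k → a k * e k))))) ⟩
    sum (λ k → a k * b k) - sum (λ k → a k * e k) * w ∎

  -- V is the reduced row echelon form of the rows of M selected by `rows`; its pivots sit in the columns `cols`.
  record Elimination {p B} (M : Fin p → Fin B → Carrier) : Set (c ⊔ ℓ) where
    field
      rank             : ℕ
      rows             : Fin rank → Fin p
      cols             : Fin rank → Fin B
      V                : Fin rank → Fin B → Carrier
      V-rational       : ∀ k b → Rational (V k b)
      V-cols           : ∀ k l → V k (cols l) ≈ δ k l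
      expand           : ∀ i b → M i b ≈ ∑[ k < rank ] (M i (cols k) * V k b)
      V-rowSpan        : ∀ k → InSpan K (M ∘ rows) (V k)
      rows-independent : LinIndep K (M ∘ rows)

    independent-on-cols : ∀ (d : Fin rank → Carrier) → (∀ m → ∑[ l < rank ] (d l * M (rows l) (cols m)) ≈ 0#) → ∀ l → d l ≈ 0#
    independent-on-cols d vanishes = Span.independence (M ∘ rows) rows-independent d λ b → begin
      ∑[ l < rank ] (d l * M (rows l) b)
        ≈⟨ sum-cong-≋ (λ l → *-congˡ (expand (rows l) b)) ⟩
      ∑[ l < rank ] (d l * ∑[ k < rank ] (M (rows l) (cols k) * V k b))
        ≈⟨ ∑-∑-* d (λ l k → M (rows l) (cols k)) (λ k → V k b) ⟩
      ∑[ k < rank ] (∑[ l < rank ] (d l * M (rows l) (cols k)) * V k b)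
        ≈⟨ sum-zero (λ k → trans (*-congʳ (vanishes k)) (zeroˡ (V k b))) ⟩
      0# ∎

    A : Fin rank → Fin rank → Carrier
    A k = Span.coefficients (M ∘ rows) (V-rowSpan k)

    rowCoefficients : Fin p → Fin rank → Carrier
    rowCoefficients i l = ∑[ k < rank ] (M i (cols k) * A k l)

    rows-span : ∀ i b → ∑[ l < rank ] (rowCoefficients i l * M (rows l) b) ≈ M i b
    rows-span i b = begin
      ∑[ l < rank ] (rowCoefficients i l * M (rows l) b)
        ≈⟨ sym (∑-∑-* (λ k → M i (cols k)) A (λ l → M (rows l) b)) ⟩
      ∑[ k < rank ] (M i (cols k) * ∑[ l < rank ] (A k l * M (rows l) b))
        ≈⟨ sum-cong-≋ (λ k → *-congˡ (Span.expansion (M ∘ rows) (V-rowSpan k) b)) ⟩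
      ∑[ k < rank ] (M i (cols k) * V k b)
        ≈⟨ sym (expand i b) ⟩
      M i b ∎

    cols-independent : ∀ (cs : Fin rank → Carrier) → (∀ i → ∑[ j < rank ] (cs j * M i (cols j)) ≈ 0#) → ∀ k → cs k ≈ 0#
    cols-independent cs vanishes k = begin
      cs k
        ≈⟨ sym (∑-δˡ cs k) ⟩
      ∑[ j < rank ] (δ k j * cs j)
        ≈⟨ sum-cong-≋ (λ j → trans (*-comm _ _) (*-congˡ (sym (V-cols k j)))) ⟩
      ∑[ j < rank ] (cs j * V k (cols j))
        ≈⟨ sum-cong-≋ (λ j → *-congˡ (sym (Span.expansion (M ∘ rows) (V-rowSpan k) (cols j)))) ⟩
      ∑[ j < rank ] (cs j * ∑[ l < rank ] (A k l * M (rows l) (cols j)))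
        ≈⟨ ∑-∑-swap cs (A k) (λ j l → M (rows l) (cols j)) ⟩
      ∑[ l < rank ] (A k l * ∑[ j < rank ] (cs j * M (rows l) (cols j)))
        ≈⟨ sum-zero (λ l → trans (*-congˡ (vanishes (rows l))) (zeroʳ (A k l))) ⟩
      0# ∎

  WindowDetermined : ∀ {a} {X : Set a} {p B} → (Fin p → X → Carrier) → (Fin B → X) → Set (a ⊔ c ⊔ ℓ)
  WindowDetermined {p = p} F w = ∀ {d} (α : Fin d → Carrier) (ι : Fin d → Fin p) →
    (∀ b → ∑[ l < d ] (α l * F (ι l) (w b)) ≈ 0#) → ∀ x → ∑[ l < d ] (α l * F (ι l) x) ≈ 0#

  module _ (charZero : CharZero K) where

    -- Either the residual of the new row M zero vanishes, or it supplies a new pivot.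
    module AddRow {p B} (M : Fin (ℕ.suc p) → Fin B → Carrier) (M-rational : ∀ i b → Rational (M i b))
                  (E : Elimination (M ∘ suc)) where

      open Elimination E

      x : Fin B → Carrier
      x = M zero

      projection : Fin B → Carrier
      projection b = ∑[ k < rank ] (x (cols k) * V k b)

      residual : Fin B → Carrier
      residual b = x b - projection b

      residual-rational : ∀ b → Rational (residual b)
      residual-rational b = Rational-+ (M-rational zero b) (Rational-neg (Rational-sum _ λ k → Rational-* (M-rational zero (cols k)) (V-rational k b)))

      residual-cols : ∀ l → residual (cols l) ≈ 0#
      residual-cols l = begin
        x (cols l) - ∑[ k < rank ] (x (cols k) * V k (cols l)) ≈⟨ +-congˡ (-‿cong (sum-cong-≋ (λ k → *-congˡ (V-cols k l)))) ⟩
        x (cols l) - ∑[ k < rank ] (x (cols k) * δ k l)       ≈⟨ +-congˡ (-‿cong (∑-δ (x ∘ cols) l)) ⟩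
        x (cols l) - x (cols l)                               ≈⟨ -‿inverseʳ _ ⟩
        0#                                                    ∎

      dependent : (∀ b → residual b ≈ 0#) → Elimination M
      dependent residual≈0 = record
        { Elimination E
        ; rows   = suc ∘ rows
        ; expand = λ { zero b → x-y≈0⇒x≈y (residual≈0 b) ; (suc i) b → expand i b }
        }

      module Pivot (c₀ : Fin B) (s≉0 : ¬ residual c₀ ≈ 0#) where

        s t : Carrier
        s = residual c₀
        t = proj₁ (inverse s s≉0)

        s*t≈1 : s * t ≈ 1#
        s*t≈1 = proj₂ (inverse s s≉0)

        W : Fin B → Carrier
        W b = t * residual b

        rows′ : Fin (ℕ.suc rank) → Fin (ℕ.suc p)
        rows′ = zero ∷ suc ∘ rows

        cols′ : Fin (ℕ.suc rank) → Fin B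
        cols′ = c₀ ∷ cols

        V′ : Fin (ℕ.suc rank) → Fin B → Carrier
        V′ = W ∷ λ k b → V k b - V k c₀ * W b

        V′-rational : ∀ k b → Rational (V′ k b)
        V′-rational zero    b = Rational-* (Rational-inverse charZero s*t≈1 (residual-rational c₀)) (residual-rational b)
        V′-rational (suc k) b = Rational-+ (V-rational k b) (Rational-neg (Rational-* (V-rational k c₀) (V′-rational zero b)))

        W-cols : ∀ l → W (cols l) ≈ 0#
        W-cols l = trans (*-congˡ (residual-cols l)) (zeroʳ t)

        V′-cols : ∀ k l → V′ k (cols′ l) ≈ δ k l
        V′-cols zero    zero    = trans (*-comm t s) s*t≈1
        V′-cols zero    (suc l) = W-cols l
        V′-cols (suc k) zero    = begin
          V k c₀ - V k c₀ * (t * s) ≈⟨ +-congˡ (-‿cong (trans (*-congˡ (trans (*-comm t s) s*t≈1)) (*-identityʳ _))) ⟩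
          V k c₀ - V k c₀           ≈⟨ -‿inverseʳ _ ⟩
          0#                        ∎
        V′-cols (suc k) (suc l) = begin
          V k (cols l) - V k c₀ * W (cols l) ≈⟨ +-cong (V-cols k l) (-‿cong (trans (*-congˡ (W-cols l)) (zeroʳ _))) ⟩
          δ k l - 0#                         ≈⟨ trans (+-congˡ -0#≈0#) (+-identityʳ _) ⟩
          δ k l                              ≈⟨ sym (δ-suc k l) ⟩
          δ (suc k) (suc l)                  ∎

        expand′ : ∀ i b → M i b ≈ ∑[ k < ℕ.suc rank ] (M i (cols′ k) * V′ k b)
        expand′ zero b = sym (begin
          x c₀ * W b + ∑[ k < rank ] (x (cols k) * (V k b - V k c₀ * W b))
            ≈⟨ +-congˡ (∑-*-sub (x ∘ cols) (λ k → V k b) (λ k → V k c₀) (W b)) ⟩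
          x c₀ * W b + (projection b - projection c₀ * W b)
            ≈⟨ solve 5 (λ xc₀ t xb Pb Pc₀ → xc₀ :* (t :* (xb :- Pb)) :+ (Pb :- Pc₀ :* (t :* (xb :- Pb)))
                                          := Pb :+ (xc₀ :- Pc₀) :* t :* (xb :- Pb)) refl (x c₀) t (x b) (projection b) (projection c₀) ⟩
          projection b + s * t * residual b
            ≈⟨ +-congˡ (trans (*-congʳ s*t≈1) (*-identityˡ _)) ⟩
          projection b + (x b - projection b)
            ≈⟨ solve 2 (λ xb Pb → Pb :+ (xb :- Pb) := xb) refl (x b) (projection b) ⟩
          x b ∎)
        expand′ (suc i) b = sym (begin
          y c₀ * W b + ∑[ k < rank ] (y (cols k) * (V k b - V k c₀ * W b))
            ≈⟨ +-congˡ (∑-*-sub (y ∘ cols) (λ k → V k b) (λ k → V k c₀) (W b)) ⟩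
          y c₀ * W b + (∑[ k < rank ] (y (cols k) * V k b) - ∑[ k < rank ] (y (cols k) * V k c₀) * W b)
            ≈⟨ +-congˡ (+-cong (sym (expand i b)) (-‿cong (*-congʳ (sym (expand i c₀))))) ⟩
          y c₀ * W b + (y b - y c₀ * W b)
            ≈⟨ solve 3 (λ a yb w → a :* w :+ (yb :- a :* w) := yb) refl (y c₀) (y b) (W b) ⟩
          y b ∎)
          where
          y = M (suc i)

        open Span (M ∘ rows′) using (member; linear; ∑-closed) renaming (resp to resp′)

        W-rowSpan : InSpan K (M ∘ rows′) W
        W-rowSpan = resp′ (λ b → solve 3 (λ t a b → t :* a :+ (:- t) :* b := t :* (a :- b)) refl t (x b) (projection b))
          (linear t (- t) (member zero) (∑-closed (x ∘ cols) V (λ k → InSpan-tail (M ∘ rows′) (V-rowSpan k))))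

        V′-rowSpan : ∀ k → InSpan K (M ∘ rows′) (V′ k)
        V′-rowSpan zero    = W-rowSpan
        V′-rowSpan (suc k) = resp′ (λ b → trans (+-congʳ (*-identityˡ _)) (+-congˡ (sym (-‿distribˡ-* _ _))))
          (linear 1# (- V k c₀) (InSpan-tail (M ∘ rows′) (V-rowSpan k)) W-rowSpan)

        rows′-independent : LinIndep K (M ∘ rows′)
        rows′-independent = Span.linIndep (M ∘ rows′) independent
          where
          r : Fin rank → Fin B → Carrier
          r l = M (suc (rows l))

          e : Fin rank → Carrier
          e l = ∑[ k < rank ] (x (cols k) * A k l)

          projection≈ : ∀ b → projection b ≈ ∑[ l < rank ] (e l * r l b)
          projection≈ b = trans (sum-cong-≋ (λ k → *-congˡ (sym (Span.expansion (M ∘ suc ∘ rows) (V-rowSpan k) b))))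
                                (∑-∑-* (x ∘ cols) A (λ l → r l b))

          module _ (cs : Fin (ℕ.suc rank) → Carrier) (vanishes : ∀ b → ∑[ j < ℕ.suc rank ] (cs j * M (rows′ j) b) ≈ 0#) where

            d : Fin rank → Carrier
            d l = cs (suc l) + cs zero * e l

            split : ∀ b → ∑[ j < ℕ.suc rank ] (cs j * M (rows′ j) b) ≈ cs zero * residual b + ∑[ l < rank ] (d l * r l b)
            split b = begin
              cs zero * x b + ∑[ l < rank ] (cs (suc l) * r l b)
                ≈⟨ +-congʳ (*-congˡ (solve 2 (λ xb Pb → xb := (xb :- Pb) :+ Pb) refl (x b) (projection b))) ⟩
              cs zero * (residual b + projection b) + ∑[ l < rank ] (cs (suc l) * r l b)
                ≈⟨ +-congʳ (*-congˡ (+-congˡ (projection≈ b))) ⟩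
              cs zero * (residual b + ∑[ l < rank ] (e l * r l b)) + ∑[ l < rank ] (cs (suc l) * r l b)
                ≈⟨ solve 4 (λ c z S T → c :* (z :+ S) :+ T := c :* z :+ (c :* S :+ T)) refl
                           (cs zero) (residual b) (∑[ l < rank ] (e l * r l b)) (∑[ l < rank ] (cs (suc l) * r l b)) ⟩
              cs zero * residual b + (cs zero * ∑[ l < rank ] (e l * r l b) + ∑[ l < rank ] (cs (suc l) * r l b))
                ≈⟨ +-congˡ (+-congʳ (*-distribˡ-sum (cs zero) (λ l → e l * r l b))) ⟩
              cs zero * residual b + (∑[ l < rank ] (cs zero * (e l * r l b)) + ∑[ l < rank ] (cs (suc l) * r l b))
                ≈⟨ +-congˡ (sym (∑-distrib-+ (λ l → cs zero * (e l * r l b)) (λ l → cs (suc l) * r l b))) ⟩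
              cs zero * residual b + ∑[ l < rank ] (cs zero * (e l * r l b) + cs (suc l) * r l b)
                ≈⟨ +-congˡ (sum-cong-≋ (λ l → solve 4 (λ c₀ f rb c → c₀ :* (f :* rb) :+ c :* rb := (c :+ c₀ :* f) :* rb)
                                                     refl (cs zero) (e l) (r l b) (cs (suc l)))) ⟩
              cs zero * residual b + ∑[ l < rank ] (d l * r l b) ∎

            d≈0 : ∀ l → d l ≈ 0#
            d≈0 = independent-on-cols d λ m → begin
              ∑[ l < rank ] (d l * r l (cols m))                          ≈⟨ sym (+-identityˡ _) ⟩
              0# + ∑[ l < rank ] (d l * r l (cols m))                     ≈⟨ +-congʳ (sym (trans (*-congˡ (residual-cols m)) (zeroʳ _))) ⟩
              cs zero * residual (cols m) + ∑[ l < rank ] (d l * r l (cols m)) ≈⟨ sym (split (cols m)) ⟩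
              ∑[ j < ℕ.suc rank ] (cs j * M (rows′ j) (cols m))           ≈⟨ vanishes (cols m) ⟩
              0#                                                          ∎

            cs₀≈0 : cs zero ≈ 0#
            cs₀≈0 = x*s≈0⇒x≈0 s≉0 (begin
              cs zero * s                                       ≈⟨ sym (+-identityʳ _) ⟩
              cs zero * s + 0#                                  ≈⟨ +-congˡ (sym (sum-zero (λ l → trans (*-congʳ (d≈0 l)) (zeroˡ _)))) ⟩
              cs zero * s + ∑[ l < rank ] (d l * r l c₀)        ≈⟨ sym (split c₀) ⟩
              ∑[ j < ℕ.suc rank ] (cs j * M (rows′ j) c₀)       ≈⟨ vanishes c₀ ⟩
              0#                                                ∎)

            independent : ∀ j → cs j ≈ 0#
            independent zero    = cs₀≈0
            independent (suc l) = begin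
              cs (suc l)                      ≈⟨ solve 3 (λ a b f → a := (a :+ b :* f) :- b :* f) refl (cs (suc l)) (cs zero) (e l) ⟩
              d l - cs zero * e l             ≈⟨ +-cong (d≈0 l) (-‿cong (trans (*-congʳ cs₀≈0) (zeroˡ _))) ⟩
              0# - 0#                         ≈⟨ -‿inverseʳ 0# ⟩
              0#                              ∎

        elimination : Elimination M
        elimination = record
          { rank = ℕ.suc rank ; rows = rows′ ; cols = cols′ ; V = V′ ; V-rational = V′-rational ; V-cols = V′-cols
          ; expand = expand′ ; V-rowSpan = V′-rowSpan ; rows-independent = rows′-independent }

      elimination : Elimination M
      elimination = fromPivotSearch (Fin.any? (λ b → ¬? (Rational-zero? charZero (residual-rational b))))
        where
        fromPivotSearch : Dec (∃ λ b → ¬ residual b ≈ 0#) → Elimination M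
        fromPivotSearch (yes (c₀ , s≉0)) = Pivot.elimination c₀ s≉0
        fromPivotSearch (no no-pivot)     = dependent λ b → decide b (Rational-zero? charZero (residual-rational b))
          where
          decide : ∀ b → Dec (residual b ≈ 0#) → residual b ≈ 0#
          decide b (yes ≈0) = ≈0
          decide b (no ≉0)  = ⊥-elim (no-pivot (b , ≉0))

    eliminate : ∀ {p B} (M : Fin p → Fin B → Carrier) → (∀ i b → Rational (M i b)) → Elimination M
    eliminate {ℕ.zero}  M _ = record
      { rank = 0 ; rows = λ () ; cols = λ () ; V = λ () ; V-rational = λ () ; V-cols = λ ()
      ; expand = λ () ; V-rowSpan = λ () ; rows-independent = λ _ _ () }
    eliminate {ℕ.suc p} M M-rational = AddRow.elimination M M-rational (eliminate (M ∘ suc) (M-rational ∘ suc))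

    rankFactorisation : ∀ {a} {X : Set a} {p B} (F : Fin p → X → Carrier) (w : Fin B → X) →
      WindowDetermined F w → (∀ i b → Rational (F i (w b))) → Σ ℕ λ r → SpanDim K F r × SpanDim K (λ x i → F i x) r
    rankFactorisation {X = X} {p} F w determined rational =
      rank , (rows , F-rows-independent , F-rows-span) , (w ∘ cols , F-cols-independent , F-cols-span)
      where
      open Elimination (eliminate (λ i b → F i (w b)) rational)

      F-rows-independent : LinIndep K (F ∘ rows)
      F-rows-independent cs vanishes = rows-independent cs λ b →
        trans (lincomb-cong cs _ (F ∘ rows) (λ _ → refl)) (vanishes (w b))

      F-rows-span : ∀ i → InSpan K (F ∘ rows) (F i)
      F-rows-span i = Span.inSpan (F ∘ rows) (rowCoefficients i) λ x →
        x-y≈0⇒x≈y (trans (solve 2 (λ S y → S :- y := :- y :+ S) refl (∑[ l < rank ] (rowCoefficients i l * F (rows l) x)) (F i x))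
                         (trans (+-congʳ (sym (-1*x≈-x _))) (determined α ι α-vanishes x)))
        where
        α : Fin (ℕ.suc rank) → Carrier
        α = - 1# ∷ rowCoefficients i
        ι : Fin (ℕ.suc rank) → Fin p
        ι = i ∷ rows
        α-vanishes : ∀ b → ∑[ l < ℕ.suc rank ] (α l * F (ι l) (w b)) ≈ 0#
        α-vanishes b = trans (+-cong (-1*x≈-x _) (rows-span i b)) (-‿inverseˡ _)

      F-cols-independent : LinIndep K (λ j i → F i (w (cols j)))
      F-cols-independent = Span.linIndep (λ j i → F i (w (cols j))) λ cs vanishes → cols-independent cs vanishes

      F-cols-span : ∀ x → InSpan K (λ j i → F i (w (cols j))) (λ i → F i x)
      F-cols-span x = Span.inSpan (λ j i → F i (w (cols j))) (λ k → ∑[ l < rank ] (A k l * F (rows l) x)) λ i → begin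
        ∑[ k < rank ] (∑[ l < rank ] (A k l * F (rows l) x) * F i (w (cols k)))
          ≈⟨ sum-cong-≋ (λ k → *-comm (∑[ l < rank ] (A k l * F (rows l) x)) (F i (w (cols k)))) ⟩
        ∑[ k < rank ] (F i (w (cols k)) * ∑[ l < rank ] (A k l * F (rows l) x))
          ≈⟨ ∑-∑-* (λ k → F i (w (cols k))) A (λ l → F (rows l) x) ⟩
        ∑[ l < rank ] (rowCoefficients i l * F (rows l) x)
          ≈⟨ Span.expansion (F ∘ rows) (F-rows-span i) x ⟩
        F i x ∎

  SpanDim-reindex : ∀ {i j a} {I : Set i} {J : Set j} {X : Set a} (v : I → X → Carrier) (h : J → I) →
                    (∀ i → Σ J λ j → ∀ x → v (h j) x ≈ v i x) → ∀ {d} → SpanDim K (v ∘ h) d → SpanDim K v d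
  SpanDim-reindex v h onto (b , independent , spans) =
    h ∘ b , independent , λ i → Span.resp (v ∘ h ∘ b) (proj₂ (onto i)) (spans (proj₁ (onto i)))

  SpanDim-transfer : ∀ {i a b} {I : Set i} {X : Set a} {Y : Set b} (v : I → X → Carrier) (u : I → Y → Carrier) (g : Y → X) →
                     (∀ i y → u i y ≈ v i (g y)) → (∀ x → Σ Y λ y → ∀ i → u i y ≈ v i x) →
                     ∀ {d} → SpanDim K v d → SpanDim K u d
  SpanDim-transfer v u g u≈v∘g section (b , independent , spans) = b , independent′ , spans′
    where
    independent′ : LinIndep K (u ∘ b)
    independent′ cs vanishes = independent cs λ x →
      trans (lincomb-cong cs (v ∘ b) (u ∘ b) (λ j → sym (proj₂ (section x) (b j)))) (vanishes (proj₁ (section x)))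
    spans′ : ∀ i → InSpan K (u ∘ b) (u i)
    spans′ i = proj₁ (spans i) , λ y →
      trans (lincomb-cong (proj₁ (spans i)) (u ∘ b) (v ∘ b) (λ j → u≈v∘g (b j) y)) (trans (proj₂ (spans i) (g y)) (sym (u≈v∘g i y)))

module Characters {c ℓ} (K : Field c ℓ) (n : ℕ) where
  open import Data.Bool using (Bool; true; false; if_then_else_)
  open import Data.Fin as Fin using (Fin; toℕ)
  import Data.Fin.Properties as Fin
  open import Data.Fin.Permutation using (Permutation′; _⟨$⟩ˡ_)
  open import Data.List using (List; []; _∷_; map; upTo)
  open import Data.Nat as ℕ using (zero; suc; _∸_; _!)
  import Data.Nat.Properties as ℕ
  open import Data.List.Properties using (concatMap-cong)
  open import Data.Product using (Σ; _,_; proj₁; proj₂)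
  import Data.Vec as Vec
  open import Function using (_∘_)
  import Relation.Binary.PropositionalEquality as ≡
  open FixedMonomials
  open CycleType
  open Partitions
  open LinearAlgebra using (WindowDetermined)
  open Partition

  open Field K
  open FieldArithmetic K using (ℕ→K; Rational; Rational-resp; Rational-ℕ)
  open FieldPowerSeries K
  open ℕ-Series using () renaming (geometricProduct to geometricProductℕ)
  open import Relation.Binary.Reasoning.Setoid setoid

  monomials≡exponents : ∀ m N → monomials K m N ≡.≡ exponents m N
  monomials≡exponents zero    zero    = ≡.refl
  monomials≡exponents zero    (suc N) = ≡.refl
  monomials≡exponents (suc m) N =
    concatMap-cong (λ a → ≡.cong (map (a Vec.∷_)) (monomials≡exponents m (N ∸ a))) (upTo (suc N))

  sumK-indicator : ∀ {a} {A : Set a} (b : A → Bool) xs → sumK K (map (λ x → if b x then 1# else 0#) xs) ≈ ℕ→K (count b xs)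
  sumK-indicator b []       = refl
  sumK-indicator b (x ∷ xs) with b x
  ... | true  = +-congˡ (sumK-indicator b xs)
  ... | false = trans (+-identityˡ _) (sumK-indicator b xs)

  χ≈fixedCount : ∀ N σ → χ K n N σ ≈ ℕ→K (fixedCount (σ ⟨$⟩ˡ_) N)
  χ≈fixedCount N σ = trans (sumK-indicator (isFixed (σ ⟨$⟩ˡ_)) (monomials K n N))
                           (reflexive (≡.cong (ℕ→K ∘ count (isFixed (σ ⟨$⟩ˡ_))) (monomials≡exponents n N)))

  χ≈fλ : ∀ σ ps → fixedCount (σ ⟨$⟩ˡ_) ≡.≗ geometricProductℕ ps → ∀ N → χ K n N σ ≈ fλ K ps N
  χ≈fλ σ ps fixedCount≗ N = begin
    χ K n N σ                                  ≈⟨ χ≈fixedCount N σ ⟩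
    ℕ→K (fixedCount (σ ⟨$⟩ˡ_) N)               ≡⟨ ≡.cong ℕ→K (fixedCount≗ N) ⟩
    ℕ→K (geometricProductℕ ps N)       ≈⟨ ℕ→K-geometricProduct ps N ⟩
    geometricProduct ps N                      ≈⟨ fλ≈geometricProduct ps N ⟨
    fλ K ps N                                  ∎

  F : Fin (#partitions n) → ℕ → Carrier
  F i = fFamily K n (partitionAt n i)

  cycleTypePartition : Permutation′ n → Partition n
  cycleTypePartition σ = sortComposition (proj₁ (cycleType n σ))

  cycleTypeIndex : Permutation′ n → Fin (#partitions n)
  cycleTypeIndex σ = proj₁ (partitionAt-surjective (cycleTypePartition σ))

  χ≈F : ∀ N σ → χ K n N σ ≈ F (cycleTypeIndex σ) N
  χ≈F N σ = begin
    χ K n N σ                             ≈⟨ χ≈fλ σ (parts (cycleTypePartition σ)) counts N ⟩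
    fλ K (parts (cycleTypePartition σ)) N ≡⟨ ≡.cong (λ ps → fλ K ps N) (≡.sym (proj₂ (partitionAt-surjective (cycleTypePartition σ)))) ⟩
    F (cycleTypeIndex σ) N                ∎
    where
    counts : fixedCount (σ ⟨$⟩ˡ_) ≡.≗ geometricProductℕ (parts (cycleTypePartition σ))
    counts M = ≡.trans (proj₂ (cycleType n σ) M) (≡.sym (geometricProduct-sortComposition (proj₁ (cycleType n σ)) M))

  realised : ∀ i → Σ (Permutation′ n) λ σ → ∀ N → χ K n N σ ≈ F i N
  realised i with realise (parts (partitionAt n i)) (positive (partitionAt n i)) (total (partitionAt n i))
  ... | σ , counts = σ , χ≈fλ σ (parts (partitionAt n i)) counts

  F-covers : ∀ (λ′ : Partition n) → Σ (Fin (#partitions n)) λ i → ∀ N → F i N ≈ fFamily K n λ′ N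
  F-covers λ′ = proj₁ (partitionAt-surjective λ′) , λ N → reflexive (≡.cong (λ ps → fλ K ps N) (proj₂ (partitionAt-surjective λ′)))

  F-rational : ∀ i N → Rational (F i N)
  F-rational i N = Rational-resp (trans (ℕ→K-geometricProduct ps N) (sym (fλ≈geometricProduct ps N))) (Rational-ℕ (geometricProductℕ ps N))
    where
    ps : List ℕ
    ps = parts (partitionAt n i)

  window : ℕ
  window = n ℕ.* suc (n !) ℕ.+ 1

  F-windowDetermined : WindowDetermined K F (toℕ {window})
  F-windowDetermined {d} α ι vanishes N = begin
    ∑[ l < d ] (α l * F (ι l) N)
      ≈⟨ sum-cong-≋ (λ l → *-congˡ (fλ≈geometricProduct (pss l) N)) ⟩
    ∑[ l < d ] (α l * geometricProduct (pss l) N)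
      ≈⟨ geometricProducts-window (n !) (ℕ.1≤n! n) n α pss (length≤n ∘ partitionAt n ∘ ι) (parts∣n! ∘ partitionAt n ∘ ι) below N ⟩
    0# ∎
    where
    pss : Fin d → List ℕ
    pss l = parts (partitionAt n (ι l))
    below : VanishesBelow window (λ M → ∑[ l < d ] (α l * geometricProduct (pss l) M))
    below M M<window = begin
      ∑[ l < d ] (α l * geometricProduct (pss l) M)  ≈⟨ sum-cong-≋ (λ l → *-congˡ (sym (fλ≈geometricProduct (pss l) M))) ⟩
      ∑[ l < d ] (α l * F (ι l) M)                   ≡⟨ ≡.cong (λ m → ∑[ l < d ] (α l * F (ι l) m)) (≡.sym (Fin.toℕ-fromℕ< M<window)) ⟩
      ∑[ l < d ] (α l * F (ι l) (toℕ (Fin.fromℕ< M<window))) ≈⟨ vanishes (Fin.fromℕ< M<window) ⟩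
      0#                                             ∎

-- The statement also holds for n = 0.
mainTheorem2 : ∀ {c ℓ} (K : Field c ℓ) → CharZero K → (n : ℕ) → 1 ≤ n → ∃ (λ d → SpanDim K (χ K n) d × SpanDim K (fFamily K n) d)
mainTheorem2 K charZero n _ = equalDimensions (rankFactorisation charZero F toℕ F-windowDetermined (λ i b → F-rational i (toℕ b)))
  where
  open Characters K n
  open LinearAlgebra K using (rankFactorisation; SpanDim-transfer; SpanDim-reindex)
  open Partitions using (partitionAt)
  equalDimensions : Σ ℕ (λ r → SpanDim K F r × SpanDim K (λ N i → F i N) r) → ∃ λ d → SpanDim K (χ K n) d × SpanDim K (fFamily K n) d
  equalDimensions (r , rowsDim , colsDim) = r ,
    SpanDim-transfer (λ N i → F i N) (χ K n) cycleTypeIndex χ≈F realised colsDim ,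
    SpanDim-reindex (fFamily K n) (partitionAt n) F-covers rowsDim
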